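{- Let $b\ge2$ be an integer. Then, as $n\to\infty$, $$\frac1b\sum_{t\ge1}\sum_{\substack{p_1>\cdots>p_t\ge1\\ p_1+\cdots+p_t=n}}\frac{(b-1)^n}{\binom{t+b-1}{b}}\prod_{i=1}^t\left(\frac{i+b-1}{i+b-2}\right)^{p_i}=(\gamma_b-o(1))\,b^n,$$ where $o(1)$ denotes a quantity tending to $0$ as $n\to\infty$ and $$\gamma_b=\frac1b\sum_{t\ge1}\frac{(t-1)!\,(b-1)^{(t+2)(t-1)/2}}{\prod_{i=2}^t\big((b-1)b^i-(b-1)^i(b+i-1)\big)}$$ (the empty product for $t=1$ equals $1$).
   Context: The inner sum ranges over all partitions of $n$ into $t$ distinct positive parts $p_1>\cdots>p_t\ge1$; it is empty (zero) if there are none. -}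

module Defs where

open import Data.Nat as ℕ using (ℕ; zero; suc; _∸_; _≤?_)
open import Data.Nat.Combinatorics using (_C_)
open import Data.Integer as ℤ using (ℤ)
open import Data.Rational using (ℚ; 0ℚ; 1ℚ; _+_; _*_; _-_; _÷_; ≢-nonZero)
open import Data.Rational.Properties using (_≟_)
open import Data.List using (List; []; _∷_; _++_; map; length)
open import Relation.Nullary using (yes; no)

ℕ→ℚ : ℕ → ℚ
ℕ→ℚ n = ℤ.+ n Data.Rational./ 1

ℤ→ℚ : ℤ → ℚ
ℤ→ℚ z = z Data.Rational./ 1

-- total division on ℚ (returns 0 when dividing by 0; never used on 0
-- denominators in the statement below)
_⊘_ : ℚ → ℚ → ℚ
p ⊘ q with q ≟ 0ℚ
... | yes _ = 0ℚ
... | no q≢0 = _÷_ p q {{≢-nonZero q≢0}}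

infixl 7 _⊘_

_^ℚ_ : ℚ → ℕ → ℚ
x ^ℚ zero = 1ℚ
x ^ℚ suc k = x * (x ^ℚ k)

sumℚ : List ℚ → ℚ
sumℚ [] = 0ℚ
sumℚ (x ∷ xs) = x + sumℚ xs

-- distinctParts m n : all lists p₁ > p₂ > ⋯ > p_t ≥ 1 (strictly decreasing)
-- with every pᵢ ≤ m and p₁ + ⋯ + p_t = n  (each partition listed once).
distinctParts : ℕ → ℕ → List (List ℕ)
distinctParts zero zero = [] ∷ []
distinctParts zero (suc _) = []
distinctParts (suc m) n with suc m ≤? n
... | yes _ = distinctParts m n ++ map (suc m ∷_) (distinctParts m (n ∸ suc m))
... | no _  = distinctParts m n

distinctPartitions : ℕ → List (List ℕ)
distinctPartitions n = distinctParts n n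

prodFactor : ℕ → ℕ → List ℕ → ℚ
prodFactor b i [] = 1ℚ
prodFactor b i (p ∷ ps) =
  ((ℕ→ℚ (i ℕ.+ b ∸ 1) ⊘ ℕ→ℚ (i ℕ.+ b ∸ 2)) ^ℚ p) * prodFactor b (suc i) ps

partTerm : ℕ → ℕ → List ℕ → ℚ
partTerm b n [] = 0ℚ
partTerm b n ps@(_ ∷ _) =
  (ℕ→ℚ ((b ∸ 1) ℕ.^ n) ⊘ ℕ→ℚ ((length ps ℕ.+ b ∸ 1) C b)) * prodFactor b 1 ps

S : ℕ → ℕ → ℚ
S b n = (1ℚ ⊘ ℕ→ℚ b) * sumℚ (map (partTerm b n) (distinctPartitions n))

D : ℕ → ℕ → ℤ
D b i = ℤ.+ ((b ∸ 1) ℕ.* b ℕ.^ i) ℤ.- ℤ.+ ((b ∸ 1) ℕ.^ i ℕ.* (b ℕ.+ i ∸ 1))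

prodD : ℕ → ℕ → ℤ
prodD b zero = ℤ.1ℤ
prodD b (suc zero) = ℤ.1ℤ
prodD b (suc (suc k)) = prodD b (suc k) ℤ.* D b (suc (suc k))

gammaTerm : ℕ → ℕ → ℚ
gammaTerm b t =
  ℕ→ℚ (((t ∸ 1) ℕ.!) ℕ.* (b ∸ 1) ℕ.^ (((t ℕ.+ 2) ℕ.* (t ∸ 1)) ℕ./ 2))
    ⊘ ℤ→ℚ (prodD b t)

gammaSum : ℕ → ℕ → ℚ
gammaSum b zero = 0ℚ
gammaSum b (suc T) = gammaSum b T + gammaTerm b (suc T)

gammaPartial : ℕ → ℕ → ℚ
gammaPartial b T = (1ℚ ⊘ ℕ→ℚ b) * gammaSum b T

-- Write β = b - 1, θ = β / b, and let F t n be θⁿ times the total weight ∏ᵢ ((i + β) / (i + β - 1)) ^ pᵢ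
-- of the partitions n = p₁ + ⋯ + pₜ into distinct parts, so that S b n / bⁿ = Σₜ F t n / (b C(t + β, b)).
-- Subtracting 1 from every part of a partition of n + t into t distinct parts leaves a partition of n
-- into t distinct parts, or into t - 1 of them after dropping a zero; as the weights telescope, this gives
-- F t (n + t) = u t (F t n + F (t - 1) n) with u t = β^(t-1) (t + β) / bᵗ, so that u 1 = 1, u t < 1 for
-- t ≥ 2 and u t → 0. Let G be the fixed point: G 1 = 1 and G t = u t (G t + G (t - 1)); then G t / (b C(t + β, b))
-- is the t-th term of γ_b. By induction on t, 0 ≤ F t n ≤ G t, and G t - F t n → 0 as n → ∞ because it
-- contracts by the factor u t at every step of length t. Once u t ≤ 1/3 the G t at least halve, so the
-- tails of Σ G t are uniformly small, and the finite sums converge jointly in n and T.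

module Submission where

-- ℚ's order is opened only inside this block, so that _≤_ in the statement of theorem6p7 is ℕ's.
module _ where
  open import Data.Nat as ℕ using (ℕ; zero; suc; _∸_; _⊔_; z≤n; s≤s)
  open import Data.Nat.Tactic.RingSolver using (solve-∀)
  open import Data.Nat.Induction using (<-rec)
  open import Data.Nat.Combinatorics using (_C_; nCk+nC[k+1]≡[n+1]C[k+1]; nCk≡nC[n∸k]; nC1≡n; nCn≡1)
  open import Data.Nat.DivMod using (+-distrib-/-∣ʳ; m*n/n≡m)
  open import Data.Nat.Divisibility using (divides)
  import Data.Nat.Properties as ℕₚ
  open import Data.Integer as ℤ using (ℤ; -[1+_])
  import Data.Integer.Properties as ℤₚ
  open import Data.Rational
    using (mkℚ; *<*; ℚ; 0ℚ; 1ℚ; ½; _+_; _*_; _-_; -_; _≤_; _<_; ∣_∣; toℚᵘ; positive; nonNegative; ≢-nonZero)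
  import Data.Rational.Properties as ℚₚ
  open import Data.Rational.Unnormalised using (mkℚᵘ; _≃_; *≡*; *≤*)
  import Data.Rational.Unnormalised.Properties as ℚᵘₚ
  open import Data.Product using (∃-syntax; _,_; _×_; proj₁; proj₂)
  open import Relation.Binary.PropositionalEquality
  open import Relation.Nullary using (Dec; yes; no; ¬_)
  open import Data.List using (List; []; _∷_; _++_; map; length)
  import Data.List.Properties as Listₚ
  open import Data.Sum using (inj₁; inj₂)
  open import Relation.Nullary.Negation using (contradiction)
  open import Data.Rational.Solver using (module +-*-Solver)
  open +-*-Solver
  open import Defs

  ℤ→ℚ-≡ : ∀ z {q} → mkℚᵘ z 0 ≃ toℚᵘ q → ℤ→ℚ z ≡ q
  ℤ→ℚ-≡ z z≃q = ℚₚ.toℚᵘ-injective (ℚᵘₚ.≃-trans (ℚₚ.toℚᵘ-fromℚᵘ (mkℚᵘ z 0)) z≃q)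

  toℚᵘ-ℤ→ℚ : ∀ z → mkℚᵘ z 0 ≃ toℚᵘ (ℤ→ℚ z)
  toℚᵘ-ℤ→ℚ z = ℚᵘₚ.≃-sym (ℚₚ.toℚᵘ-fromℚᵘ (mkℚᵘ z 0))

  ℤ→ℚ-homo-+ : ∀ a b → ℤ→ℚ (a ℤ.+ b) ≡ ℤ→ℚ a + ℤ→ℚ b
  ℤ→ℚ-homo-+ a b = ℤ→ℚ-≡ (a ℤ.+ b) (ℚᵘₚ.≃-trans
    (*≡* (cong₂ (λ x y → (x ℤ.+ y) ℤ.* ℤ.+ 1) (sym (ℤₚ.*-identityʳ a)) (sym (ℤₚ.*-identityʳ b))))
    (ℚᵘₚ.≃-trans (ℚᵘₚ.+-cong (toℚᵘ-ℤ→ℚ a) (toℚᵘ-ℤ→ℚ b))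
                 (ℚᵘₚ.≃-sym (ℚₚ.toℚᵘ-homo-+ (ℤ→ℚ a) (ℤ→ℚ b)))))

  ℤ→ℚ-homo-* : ∀ a b → ℤ→ℚ (a ℤ.* b) ≡ ℤ→ℚ a * ℤ→ℚ b
  ℤ→ℚ-homo-* a b = ℤ→ℚ-≡ (a ℤ.* b) (ℚᵘₚ.≃-trans (*≡* refl)
    (ℚᵘₚ.≃-trans (ℚᵘₚ.*-cong (toℚᵘ-ℤ→ℚ a) (toℚᵘ-ℤ→ℚ b))
                 (ℚᵘₚ.≃-sym (ℚₚ.toℚᵘ-homo-* (ℤ→ℚ a) (ℤ→ℚ b)))))

  ℤ→ℚ-homo‿- : ∀ a → ℤ→ℚ (ℤ.- a) ≡ - ℤ→ℚ a
  ℤ→ℚ-homo‿- a = ℤ→ℚ-≡ (ℤ.- a) (ℚᵘₚ.≃-trans (*≡* refl)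
    (ℚᵘₚ.≃-trans (ℚᵘₚ.-‿cong (toℚᵘ-ℤ→ℚ a)) (ℚᵘₚ.≃-sym (ℚₚ.toℚᵘ-homo‿- (ℤ→ℚ a)))))

  ℤ→ℚ-homo-− : ∀ a b → ℤ→ℚ (a ℤ.- b) ≡ ℤ→ℚ a - ℤ→ℚ b
  ℤ→ℚ-homo-− a b = trans (ℤ→ℚ-homo-+ a (ℤ.- b)) (cong (ℤ→ℚ a +_) (ℤ→ℚ-homo‿- b))

  ℕ→ℚ-homo-+ : ∀ m n → ℕ→ℚ (m ℕ.+ n) ≡ ℕ→ℚ m + ℕ→ℚ n
  ℕ→ℚ-homo-+ m n = trans (cong ℤ→ℚ (ℤₚ.pos-+ m n)) (ℤ→ℚ-homo-+ (ℤ.+ m) (ℤ.+ n))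

  ℕ→ℚ-homo-* : ∀ m n → ℕ→ℚ (m ℕ.* n) ≡ ℕ→ℚ m * ℕ→ℚ n
  ℕ→ℚ-homo-* m n = trans (cong ℤ→ℚ (ℤₚ.pos-* m n)) (ℤ→ℚ-homo-* (ℤ.+ m) (ℤ.+ n))

  ℕ→ℚ-homo-^ : ∀ m n → ℕ→ℚ (m ℕ.^ n) ≡ ℕ→ℚ m ^ℚ n
  ℕ→ℚ-homo-^ m zero = refl
  ℕ→ℚ-homo-^ m (suc n) = trans (ℕ→ℚ-homo-* m (m ℕ.^ n)) (cong (ℕ→ℚ m *_) (ℕ→ℚ-homo-^ m n))

  ℕ→ℚ-nonNeg : ∀ n → 0ℚ ≤ ℕ→ℚ n
  ℕ→ℚ-nonNeg n = ℚₚ.nonNegative⁻¹ _ {{ℚₚ.normalize-nonNeg n 1}}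

  ℕ→ℚ-pos : ∀ n → 0ℚ < ℕ→ℚ (suc n)
  ℕ→ℚ-pos n = ℚₚ.positive⁻¹ _ {{ℚₚ.normalize-pos (suc n) 1}}

  ℕ→ℚ-mono-≤ : ∀ {m n} → m ℕ.≤ n → ℕ→ℚ m ≤ ℕ→ℚ n
  ℕ→ℚ-mono-≤ {m} m≤n with ℕₚ.m≤n⇒∃[o]m+o≡n m≤n
  ... | k , refl = subst (_≤ ℕ→ℚ (m ℕ.+ k)) (ℚₚ.+-identityʳ _)
                      (subst (ℕ→ℚ m + 0ℚ ≤_) (sym (ℕ→ℚ-homo-+ m k)) (ℚₚ.+-monoʳ-≤ (ℕ→ℚ m) (ℕ→ℚ-nonNeg k)))

  ℕ→ℚ-mono-< : ∀ {m n} → m ℕ.< n → ℕ→ℚ m < ℕ→ℚ n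
  ℕ→ℚ-mono-< {m} m<n = ℚₚ.<-≤-trans m<1+m (ℕ→ℚ-mono-≤ m<n)
    where
    m<1+m : ℕ→ℚ m < ℕ→ℚ (suc m)
    m<1+m = subst₂ _<_ (ℚₚ.+-identityˡ _) (sym (ℕ→ℚ-homo-+ 1 m)) (ℚₚ.+-monoˡ-< (ℕ→ℚ m) (ℕ→ℚ-pos 0))

  0≤q-p⇒p≤q : ∀ {p q} → 0ℚ ≤ q - p → p ≤ q
  0≤q-p⇒p≤q {p} {q} 0≤q-p = subst₂ _≤_ (ℚₚ.+-identityʳ p)
    (solve 2 (λ p q → p :+ (q :- p) := q) refl p q) (ℚₚ.+-monoʳ-≤ p 0≤q-p)

  p≤q⇒0≤q-p : ∀ {p q} → p ≤ q → 0ℚ ≤ q - p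
  p≤q⇒0≤q-p {p} {q} p≤q = subst (_≤ q - p) (ℚₚ.+-inverseʳ p) (ℚₚ.+-monoˡ-≤ (- p) p≤q)

  0<q-p⇒p<q : ∀ {p q} → 0ℚ < q - p → p < q
  0<q-p⇒p<q {p} {q} 0<q-p = subst₂ _<_ (ℚₚ.+-identityʳ p)
    (solve 2 (λ p q → p :+ (q :- p) := q) refl p q) (ℚₚ.+-monoʳ-< p 0<q-p)

  p<q⇒0<q-p : ∀ {p q} → p < q → 0ℚ < q - p
  p<q⇒0<q-p {p} {q} p<q = subst (_< q - p) (ℚₚ.+-inverseʳ p) (ℚₚ.+-monoˡ-< (- p) p<q)

  +-nonNeg : ∀ {p q} → 0ℚ ≤ p → 0ℚ ≤ q → 0ℚ ≤ p + q
  +-nonNeg = ℚₚ.+-mono-≤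

  *-nonNeg : ∀ {p q} → 0ℚ ≤ p → 0ℚ ≤ q → 0ℚ ≤ p * q
  *-nonNeg {p} {q} 0≤p 0≤q = ℚₚ.nonNegative⁻¹ _
    {{ℚₚ.nonNeg*nonNeg⇒nonNeg p {{nonNegative 0≤p}} q {{nonNegative 0≤q}}}}

  *-pos : ∀ {p q} → 0ℚ < p → 0ℚ < q → 0ℚ < p * q
  *-pos {p} {q} 0<p 0<q = ℚₚ.positive⁻¹ _ {{ℚₚ.pos*pos⇒pos p {{positive 0<p}} q {{positive 0<q}}}}

  *-monoˡ-≤ : ∀ {r p q} → 0ℚ ≤ r → p ≤ q → r * p ≤ r * q
  *-monoˡ-≤ {r} 0≤r = ℚₚ.*-monoˡ-≤-nonNeg r {{nonNegative 0≤r}}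

  *-monoʳ-≤ : ∀ {r p q} → 0ℚ ≤ r → p ≤ q → p * r ≤ q * r
  *-monoʳ-≤ {r} 0≤r = ℚₚ.*-monoʳ-≤-nonNeg r {{nonNegative 0≤r}}

  *-cancelʳ-≤ : ∀ {r p q} → 0ℚ < r → p * r ≤ q * r → p ≤ q
  *-cancelʳ-≤ {r} 0<r = ℚₚ.*-cancelʳ-≤-pos r {{positive 0<r}}

  *-cancelʳ-< : ∀ {r p q} → 0ℚ < r → p * r < q * r → p < q
  *-cancelʳ-< {r} 0<r = ℚₚ.*-cancelʳ-<-nonNeg r {{ℚₚ.pos⇒nonNeg r {{positive 0<r}}}}

  pos⇒≢0 : ∀ {p} → 0ℚ < p → p ≢ 0ℚ
  pos⇒≢0 0<p p≡0 = ℚₚ.<-irrefl (sym p≡0) 0<p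

  p⊘q*q≡p : ∀ p {q} → q ≢ 0ℚ → (p ⊘ q) * q ≡ p
  p⊘q*q≡p p {q} q≢0 with q ℚₚ.≟ 0ℚ
  ... | yes q≡0 = contradiction q≡0 q≢0
  ... | no q≢0 = trans (ℚₚ.*-assoc p _ q)
    (trans (cong (p *_) (ℚₚ.*-inverseˡ q {{≢-nonZero q≢0}})) (ℚₚ.*-identityʳ p))

  *-cancelʳ-≡ : ∀ {r p q} → r ≢ 0ℚ → p * r ≡ q * r → p ≡ q
  *-cancelʳ-≡ {r} {p} {q} r≢0 pr≡qr = begin
    p                    ≡⟨ sym (ℚₚ.*-identityʳ p) ⟩
    p * 1ℚ               ≡⟨ cong (p *_) (sym r*1/r≡1) ⟩
    p * (r * (1ℚ ⊘ r))   ≡⟨ solve 3 (λ p r s → p :* (r :* s) := p :* r :* s) refl p r (1ℚ ⊘ r) ⟩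
    p * r * (1ℚ ⊘ r)     ≡⟨ cong (_* (1ℚ ⊘ r)) pr≡qr ⟩
    q * r * (1ℚ ⊘ r)     ≡⟨ solve 3 (λ p r s → p :* r :* s := p :* (r :* s)) refl q r (1ℚ ⊘ r) ⟩
    q * (r * (1ℚ ⊘ r))   ≡⟨ cong (q *_) r*1/r≡1 ⟩
    q * 1ℚ               ≡⟨ ℚₚ.*-identityʳ q ⟩
    q                    ∎
    where
    open ≡-Reasoning
    r*1/r≡1 : r * (1ℚ ⊘ r) ≡ 1ℚ
    r*1/r≡1 = trans (ℚₚ.*-comm r _) (p⊘q*q≡p 1ℚ r≢0)

  1⊘q≤1 : ∀ {q} → 1ℚ ≤ q → 1ℚ ⊘ q ≤ 1ℚ
  1⊘q≤1 {q} 1≤q = *-cancelʳ-≤ 0<q (subst₂ _≤_ (sym (p⊘q*q≡p 1ℚ (pos⇒≢0 0<q))) (sym (ℚₚ.*-identityˡ q)) 1≤q)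
    where 0<q = ℚₚ.<-≤-trans (ℚₚ.positive⁻¹ 1ℚ) 1≤q

  x≡u[x+y]⇒x[1-u]≡uy : ∀ x u y → x ≡ u * (x + y) → x * (1ℚ - u) ≡ u * y
  x≡u[x+y]⇒x[1-u]≡uy x u y x≡u[x+y] = begin
    x * (1ℚ - u)       ≡⟨ solve 2 (λ x u → x :* (con 1ℚ :- u) := x :- u :* x) refl x u ⟩
    x - u * x          ≡⟨ cong (_- u * x) x≡u[x+y] ⟩
    u * (x + y) - u * x ≡⟨ solve 3 (λ x u y → u :* (x :+ y) :- u :* x := u :* y) refl x u y ⟩
    u * y              ∎
    where open ≡-Reasoning

  x[1-u]≡uy⇒x≡u[x+y] : ∀ x u y → x * (1ℚ - u) ≡ u * y → x ≡ u * (x + y)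
  x[1-u]≡uy⇒x≡u[x+y] x u y x[1-u]≡uy = begin
    x                     ≡⟨ solve 2 (λ x u → x := x :* (con 1ℚ :- u) :+ u :* x) refl x u ⟩
    x * (1ℚ - u) + u * x  ≡⟨ cong (_+ u * x) x[1-u]≡uy ⟩
    u * y + u * x         ≡⟨ solve 3 (λ x u y → u :* y :+ u :* x := u :* (x :+ y)) refl x u y ⟩
    u * (x + y)           ∎
    where open ≡-Reasoning

  z*q≡p⇒p⊘q≡z : ∀ {p q z} → q ≢ 0ℚ → z * q ≡ p → p ⊘ q ≡ z
  z*q≡p⇒p⊘q≡z {p} q≢0 zq≡p = *-cancelʳ-≡ q≢0 (trans (p⊘q*q≡p p q≢0) (sym zq≡p))

  p⊘q≡p*[1⊘q] : ∀ p q → p ⊘ q ≡ p * (1ℚ ⊘ q)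
  p⊘q≡p*[1⊘q] p q with q ℚₚ.≟ 0ℚ
  ... | yes _ = sym (ℚₚ.*-zeroʳ p)
  ... | no _  = cong (p *_) (sym (ℚₚ.*-identityˡ _))

  1⊘q-pos : ∀ {q} → 0ℚ < q → 0ℚ < 1ℚ ⊘ q
  1⊘q-pos {q} 0<q = *-cancelʳ-< 0<q (subst₂ _<_ (sym (ℚₚ.*-zeroˡ q)) (sym (p⊘q*q≡p 1ℚ (pos⇒≢0 0<q))) (ℚₚ.positive⁻¹ 1ℚ))

  -- Finite sums

  sumFrom : (ℕ → ℚ) → ℕ → ℕ → ℚ
  sumFrom f a zero = 0ℚ
  sumFrom f a (suc K) = f a + sumFrom f (suc a) K

  sumFrom-shift : ∀ f a K → sumFrom f (suc a) K ≡ sumFrom (λ t → f (suc t)) a K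
  sumFrom-shift f a zero = refl
  sumFrom-shift f a (suc K) = cong (f (suc a) +_) (sumFrom-shift f (suc a) K)

  sumFrom-cong : ∀ {f g} a K → (∀ t → f t ≡ g t) → sumFrom f a K ≡ sumFrom g a K
  sumFrom-cong a zero f≗g = refl
  sumFrom-cong a (suc K) f≗g = cong₂ _+_ (f≗g a) (sumFrom-cong (suc a) K f≗g)

  sumFrom-zero : ∀ {f} a K → (∀ t → f t ≡ 0ℚ) → sumFrom f a K ≡ 0ℚ
  sumFrom-zero a zero f≗0 = refl
  sumFrom-zero a (suc K) f≗0 = cong₂ _+_ (f≗0 a) (sumFrom-zero (suc a) K f≗0)

  sumFrom-+ : ∀ f g a K → sumFrom (λ t → f t + g t) a K ≡ sumFrom f a K + sumFrom g a K
  sumFrom-+ f g a zero = refl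
  sumFrom-+ f g a (suc K) = trans (cong (f a + g a +_) (sumFrom-+ f g (suc a) K))
    (solve 4 (λ x y z w → x :+ y :+ (z :+ w) := x :+ z :+ (y :+ w)) refl
      (f a) (g a) (sumFrom f (suc a) K) (sumFrom g (suc a) K))

  sumFrom-- : ∀ f g a K → sumFrom (λ t → f t - g t) a K ≡ sumFrom f a K - sumFrom g a K
  sumFrom-- f g a zero = refl
  sumFrom-- f g a (suc K) = trans (cong (f a - g a +_) (sumFrom-- f g (suc a) K))
    (solve 4 (λ x y z w → x :- y :+ (z :- w) := x :+ z :- (y :+ w)) refl
      (f a) (g a) (sumFrom f (suc a) K) (sumFrom g (suc a) K))

  sumFrom-*ˡ : ∀ c f a K → sumFrom (λ t → c * f t) a K ≡ c * sumFrom f a K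
  sumFrom-*ˡ c f a zero = sym (ℚₚ.*-zeroʳ c)
  sumFrom-*ˡ c f a (suc K) = trans (cong (c * f a +_) (sumFrom-*ˡ c f (suc a) K))
    (sym (ℚₚ.*-distribˡ-+ c (f a) (sumFrom f (suc a) K)))

  sumFrom-split : ∀ f a j K → sumFrom f a (j ℕ.+ K) ≡ sumFrom f a j + sumFrom f (a ℕ.+ j) K
  sumFrom-split f a zero K = trans (cong (λ a → sumFrom f a K) (sym (ℕₚ.+-identityʳ a))) (sym (ℚₚ.+-identityˡ _))
  sumFrom-split f a (suc j) K = trans (cong (f a +_) (trans (sumFrom-split f (suc a) j K)
      (cong (λ b → sumFrom f (suc a) j + sumFrom f b K) (sym (ℕₚ.+-suc a j)))))
    (sym (ℚₚ.+-assoc (f a) _ _))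

  sumFrom-last : ∀ f a K → sumFrom f a (suc K) ≡ sumFrom f a K + f (a ℕ.+ K)
  sumFrom-last f a K = trans (subst (λ L → sumFrom f a L ≡ sumFrom f a K + sumFrom f (a ℕ.+ K) 1) (ℕₚ.+-comm K 1) (sumFrom-split f a K 1))
    (cong (sumFrom f a K +_) (ℚₚ.+-identityʳ _))

  sumFrom-mono-≤ : ∀ {f g} a K → (∀ t → f t ≤ g t) → sumFrom f a K ≤ sumFrom g a K
  sumFrom-mono-≤ a zero f≤g = ℚₚ.≤-refl
  sumFrom-mono-≤ a (suc K) f≤g = ℚₚ.+-mono-≤ (f≤g a) (sumFrom-mono-≤ (suc a) K f≤g)

  sumFrom-nonNeg : ∀ {f} a K → (∀ t → 0ℚ ≤ f t) → 0ℚ ≤ sumFrom f a K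
  sumFrom-nonNeg {f} a K 0≤f = subst (_≤ sumFrom f a K) (sumFrom-zero a K (λ _ → refl)) (sumFrom-mono-≤ a K 0≤f)

  -- Eventually small sequences

  archimedean : ∀ p → ∃[ k ] p ≤ ℕ→ℚ k
  archimedean (mkℚ (ℤ.+ m) d _) = m , ℚₚ.toℚᵘ-cancel-≤ (ℚᵘₚ.≤-respʳ-≃ (toℚᵘ-ℤ→ℚ (ℤ.+ m))
    (*≤* (subst₂ ℤ._≤_ (ℤₚ.pos-* m 1) (ℤₚ.pos-* m (suc d)) (ℤ.+≤+ (ℕₚ.*-monoʳ-≤ m (s≤s z≤n))))))
  archimedean (mkℚ -[1+ m ] d _) = 0 , ℚₚ.toℚᵘ-cancel-≤ (ℚᵘₚ.≤-respʳ-≃ (toℚᵘ-ℤ→ℚ (ℤ.+ 0)) (*≤* ℤ.-≤+))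

  archimedean-* : ∀ p {q} → 0ℚ < q → ∃[ k ] p ≤ ℕ→ℚ k * q
  archimedean-* p {q} 0<q with archimedean (p * (1ℚ ⊘ q))
  ... | k , p/q≤k = k , subst (_≤ ℕ→ℚ k * q) p/q*q≡p (*-monoʳ-≤ (ℚₚ.<⇒≤ 0<q) p/q≤k)
    where
    p/q*q≡p : p * (1ℚ ⊘ q) * q ≡ p
    p/q*q≡p = trans (ℚₚ.*-assoc p _ q) (trans (cong (p *_) (p⊘q*q≡p 1ℚ (pos⇒≢0 0<q))) (ℚₚ.*-identityʳ p))

  pow-nonNeg : ∀ {c} k → 0ℚ ≤ c → 0ℚ ≤ c ^ℚ k
  pow-nonNeg zero 0≤c = ℚₚ.<⇒≤ (ℚₚ.positive⁻¹ 1ℚ)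
  pow-nonNeg (suc k) 0≤c = *-nonNeg 0≤c (pow-nonNeg k 0≤c)

  pow-+ : ∀ c m n → c ^ℚ (m ℕ.+ n) ≡ c ^ℚ m * c ^ℚ n
  pow-+ c zero n = sym (ℚₚ.*-identityˡ _)
  pow-+ c (suc m) n = trans (cong (c *_) (pow-+ c m n)) (sym (ℚₚ.*-assoc c _ _))

  pow-*-distrib : ∀ c d n → (c * d) ^ℚ n ≡ c ^ℚ n * d ^ℚ n
  pow-*-distrib c d zero = refl
  pow-*-distrib c d (suc n) = trans (cong ((c * d) *_) (pow-*-distrib c d n))
    (solve 4 (λ c d x y → (c :* d) :* (x :* y) := (c :* x) :* (d :* y)) refl c d (c ^ℚ n) (d ^ℚ n))

  bernoulli : ∀ {c} k → 0ℚ ≤ c → c ≤ 1ℚ → c ^ℚ k * (1ℚ + ℕ→ℚ k * (1ℚ - c)) ≤ 1ℚ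
  bernoulli {c} zero 0≤c c≤1 = ℚₚ.≤-reflexive (solve 1 (λ c → con 1ℚ :* (con 1ℚ :+ con 0ℚ :* (con 1ℚ :- c)) := con 1ℚ) refl c)
  bernoulli {c} (suc k) 0≤c c≤1 = ℚₚ.≤-trans (0≤q-p⇒p≤q (subst (0ℚ ≤_) gap gap-nonNeg)) (bernoulli k 0≤c c≤1)
    where
    K = ℕ→ℚ k
    0≤1-c = p≤q⇒0≤q-p c≤1
    gap-nonNeg : 0ℚ ≤ c ^ℚ k * ((1ℚ - c) * (1ℚ - c) * (1ℚ + K))
    gap-nonNeg = *-nonNeg (pow-nonNeg k 0≤c)
      (*-nonNeg (*-nonNeg 0≤1-c 0≤1-c) (+-nonNeg (ℚₚ.<⇒≤ (ℚₚ.positive⁻¹ 1ℚ)) (ℕ→ℚ-nonNeg k)))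
    gap : c ^ℚ k * ((1ℚ - c) * (1ℚ - c) * (1ℚ + K))
        ≡ c ^ℚ k * (1ℚ + K * (1ℚ - c)) - c ^ℚ suc k * (1ℚ + ℕ→ℚ (suc k) * (1ℚ - c))
    gap = trans (solve 3 (λ c P K → P :* ((con 1ℚ :- c) :* (con 1ℚ :- c) :* (con 1ℚ :+ K))
                     := P :* (con 1ℚ :+ K :* (con 1ℚ :- c)) :- c :* P :* (con 1ℚ :+ (con 1ℚ :+ K) :* (con 1ℚ :- c)))
                 refl c (c ^ℚ k) K)
      (cong (λ x → c ^ℚ k * (1ℚ + K * (1ℚ - c)) - c ^ℚ suc k * (1ℚ + x * (1ℚ - c))) (sym (ℕ→ℚ-homo-+ 1 k)))

  geometric-decay : ∀ {c x δ} → 0ℚ ≤ c → c < 1ℚ → 0ℚ ≤ x → 0ℚ < δ → ∃[ k ] c ^ℚ k * x ≤ δ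
  geometric-decay {c} {x} {δ} 0≤c c<1 0≤x 0<δ = decay (archimedean-* x (*-pos 0<δ (p<q⇒0<q-p c<1)))
    where
    open ℚₚ.≤-Reasoning
    decay : ∃[ k ] x ≤ ℕ→ℚ k * (δ * (1ℚ - c)) → ∃[ k ] c ^ℚ k * x ≤ δ
    decay (k , x≤kδ[1-c]) = k , (begin
      c ^ℚ k * x                          ≤⟨ *-monoˡ-≤ 0≤cᵏ x≤kδ[1-c] ⟩
      c ^ℚ k * (K * (δ * (1ℚ - c)))      ≤⟨ *-monoˡ-≤ 0≤cᵏ (0≤q-p⇒p≤q (subst (0ℚ ≤_) slack (ℚₚ.<⇒≤ 0<δ))) ⟩
      c ^ℚ k * (δ * B)                    ≡⟨ solve 3 (λ x d y → x :* (d :* y) := d :* (x :* y)) refl (c ^ℚ k) δ B ⟩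
      δ * (c ^ℚ k * B)                    ≤⟨ *-monoˡ-≤ (ℚₚ.<⇒≤ 0<δ) (bernoulli k 0≤c (ℚₚ.<⇒≤ c<1)) ⟩
      δ * 1ℚ                              ≡⟨ ℚₚ.*-identityʳ δ ⟩
      δ                                   ∎)
      where
      K = ℕ→ℚ k
      B = 1ℚ + K * (1ℚ - c)
      0≤cᵏ = pow-nonNeg k 0≤c
      slack : δ ≡ δ * B - K * (δ * (1ℚ - c))
      slack = solve 3 (λ d K c → d := d :* (con 1ℚ :+ K :* (con 1ℚ :- c)) :- K :* (d :* (con 1ℚ :- c))) refl δ K c

  half-pos : ∀ {δ} → 0ℚ < δ → 0ℚ < δ * ½
  half-pos 0<δ = *-pos 0<δ (ℚₚ.positive⁻¹ ½)

  halves : ∀ δ → δ * ½ + δ * ½ ≡ δ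
  halves δ = solve 1 (λ d → d :* con ½ :+ d :* con ½ := d) refl δ

  ∣p-q∣≤r : ∀ {p q r} → 0ℚ ≤ p → p ≤ r → 0ℚ ≤ q → q ≤ r → ∣ p - q ∣ ≤ r
  ∣p-q∣≤r {p} {q} {r} 0≤p p≤r 0≤q q≤r with ℚₚ.∣p∣≡p∨∣p∣≡-p (p - q)
  ... | inj₁ ∣p-q∣≡p-q = subst (_≤ r) (sym ∣p-q∣≡p-q)
    (ℚₚ.≤-trans (0≤q-p⇒p≤q (subst (0ℚ ≤_) (solve 2 (λ p q → q := p :- (p :- q)) refl p q) 0≤q)) p≤r)
  ... | inj₂ ∣p-q∣≡q-p = subst (_≤ r) (sym ∣p-q∣≡q-p)
    (ℚₚ.≤-trans (0≤q-p⇒p≤q (subst (0ℚ ≤_) (solve 2 (λ p q → p := q :- (:- (p :- q))) refl p q) 0≤p)) q≤r)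

  Limsup≤0 : (ℕ → ℚ) → Set
  Limsup≤0 e = ∀ δ → 0ℚ < δ → ∃[ M ] ∀ n → M ℕ.≤ n → e n ≤ δ

  [M+js+o]+s≡M+[1+j]s+o : ∀ M j s o → M ℕ.+ j ℕ.* suc s ℕ.+ o ℕ.+ suc s ≡ M ℕ.+ suc j ℕ.* suc s ℕ.+ o
  [M+js+o]+s≡M+[1+j]s+o = solve-∀

  contraction-Limsup≤0 : ∀ {e a : ℕ → ℚ} {U K : ℚ} s → 0ℚ ≤ U → U < 1ℚ → 0ℚ ≤ K →
    (∀ n → e n ≤ K) → (∀ n → e (n ℕ.+ suc s) ≤ U * (e n + a n)) → Limsup≤0 a → Limsup≤0 e
  contraction-Limsup≤0 {e} {a} {U} {K} s 0≤U U<1 0≤K e≤K step a→0 δ 0<δ =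
    conclude (a→0 ((1ℚ - U) * h) (*-pos 0<1-U (half-pos 0<δ))) (geometric-decay 0≤U U<1 0≤K (half-pos 0<δ))
    where
    h = δ * ½
    0≤h = ℚₚ.<⇒≤ (half-pos 0<δ)
    0<1-U = p<q⇒0<q-p U<1
    0≤1-U = ℚₚ.<⇒≤ 0<1-U

    contract : ∀ j {x y} → x ≤ U ^ℚ j * K + h → y ≤ (1ℚ - U) * h → U * (x + y) ≤ U ^ℚ suc j * K + h
    contract j {x} {y} x≤ y≤ = ℚₚ.≤-trans (*-monoˡ-≤ 0≤U (ℚₚ.+-mono-≤ x≤ y≤))
      (0≤q-p⇒p≤q (subst (0ℚ ≤_) gap (*-nonNeg (*-nonNeg 0≤h 0≤1-U) 0≤1-U)))
      where
      gap : h * (1ℚ - U) * (1ℚ - U) ≡ U ^ℚ suc j * K + h - U * ((U ^ℚ j * K + h) + (1ℚ - U) * h)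
      gap = solve 4 (λ h U P K → h :* (con 1ℚ :- U) :* (con 1ℚ :- U)
                               := U :* P :* K :+ h :- U :* ((P :* K :+ h) :+ (con 1ℚ :- U) :* h))
                    refl h U (U ^ℚ j) K

    module _ (M : ℕ) (a≤ : ∀ n → M ℕ.≤ n → a n ≤ (1ℚ - U) * h) where
      iterate : ∀ j n → M ℕ.+ j ℕ.* suc s ℕ.≤ n → e n ≤ U ^ℚ j * K + h
      iterate zero n _ = ℚₚ.≤-trans (e≤K n)
        (0≤q-p⇒p≤q (subst (0ℚ ≤_) (solve 2 (λ K h → h := con 1ℚ :* K :+ h :- K) refl K h) 0≤h))
      iterate (suc j) n M+[1+j]s≤n = subst (λ n → e n ≤ U ^ℚ suc j * K + h) n≡m+s
        (ℚₚ.≤-trans (step m) (contract j (iterate j m M+js≤m) (a≤ m M≤m)))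
        where
        o = n ∸ (M ℕ.+ suc j ℕ.* suc s)
        m = M ℕ.+ j ℕ.* suc s ℕ.+ o
        n≡m+s : m ℕ.+ suc s ≡ n
        n≡m+s = trans ([M+js+o]+s≡M+[1+j]s+o M j s o) (ℕₚ.m+[n∸m]≡n M+[1+j]s≤n)
        M+js≤m = ℕₚ.m≤m+n (M ℕ.+ j ℕ.* suc s) o
        M≤m = ℕₚ.≤-trans (ℕₚ.m≤m+n M (j ℕ.* suc s)) M+js≤m

    conclude : ∃[ M ] (∀ n → M ℕ.≤ n → a n ≤ (1ℚ - U) * h) → ∃[ k ] U ^ℚ k * K ≤ h →
               ∃[ N ] ∀ n → N ℕ.≤ n → e n ≤ δ
    conclude (M , a≤) (k , Uᵏ*K≤h) = M ℕ.+ k ℕ.* suc s , λ n le →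
      ℚₚ.≤-trans (iterate M a≤ k n le) (subst (U ^ℚ k * K + h ≤_) (halves δ) (ℚₚ.+-monoˡ-≤ h Uᵏ*K≤h))

  sumFrom-Limsup≤0 : ∀ (d : ℕ → ℕ → ℚ) a K → (∀ t → Limsup≤0 (d t)) →
    Limsup≤0 (λ n → sumFrom (λ t → d t n) a K)
  sumFrom-Limsup≤0 d a zero d→0 δ 0<δ = 0 , λ _ _ → ℚₚ.<⇒≤ 0<δ
  sumFrom-Limsup≤0 d a (suc K) d→0 δ 0<δ =
    combine (d→0 a (δ * ½) (half-pos 0<δ)) (sumFrom-Limsup≤0 d (suc a) K d→0 (δ * ½) (half-pos 0<δ))
    where
    combine : ∃[ M ] (∀ n → M ℕ.≤ n → d a n ≤ δ * ½) →
              ∃[ M ] (∀ n → M ℕ.≤ n → sumFrom (λ t → d t n) (suc a) K ≤ δ * ½) →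
              ∃[ M ] ∀ n → M ℕ.≤ n → sumFrom (λ t → d t n) a (suc K) ≤ δ
    combine (M₁ , head≤) (M₂ , rest≤) = M₁ ⊔ M₂ , λ n le → subst (_ ≤_) (halves δ)
      (ℚₚ.+-mono-≤ (head≤ n (ℕₚ.≤-trans (ℕₚ.m≤m⊔n M₁ M₂) le)) (rest≤ n (ℕₚ.≤-trans (ℕₚ.m≤n⊔m M₁ M₂) le)))

  Limsup≤0-mono : ∀ {d e : ℕ → ℚ} → (∀ n → d n ≤ e n) → Limsup≤0 e → Limsup≤0 d
  Limsup≤0-mono {d} {e} d≤e e→0 δ 0<δ = weaken (e→0 δ 0<δ)
    where
    weaken : ∃[ M ] (∀ n → M ℕ.≤ n → e n ≤ δ) → ∃[ M ] (∀ n → M ℕ.≤ n → d n ≤ δ)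
    weaken (M , e≤δ) = M , λ n M≤n → ℚₚ.≤-trans (d≤e n) (e≤δ n M≤n)

  SmallTails : (ℕ → ℚ) → Set
  SmallTails G = ∀ η → 0ℚ < η → ∃[ T ] ∀ J → sumFrom G T J ≤ η

  halving⇒SmallTails : ∀ {G : ℕ → ℚ} t₀ → (∀ t → 0ℚ ≤ G t) →
    (∀ t → t₀ ℕ.≤ t → G (suc t) + G (suc t) ≤ G t) → SmallTails G
  halving⇒SmallTails {G} t₀ 0≤G halving η 0<η =
    conclude (geometric-decay 0≤½ ½<1 (0≤G t₀) (half-pos 0<η))
    where
    0≤½ = ℚₚ.<⇒≤ (ℚₚ.positive⁻¹ ½)
    ½<1 : ½ < 1ℚ
    ½<1 = *<* (ℤ.+<+ (s≤s (s≤s z≤n)))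

    tail≤ : ∀ J a → t₀ ℕ.≤ a → sumFrom G a J ≤ G a + G a
    tail≤ zero a _ = +-nonNeg (0≤G a) (0≤G a)
    tail≤ (suc J) a t₀≤a = ℚₚ.+-monoʳ-≤ (G a)
      (ℚₚ.≤-trans (tail≤ J (suc a) (ℕₚ.m≤n⇒m≤1+n t₀≤a)) (halving a t₀≤a))

    decay : ∀ j → G (j ℕ.+ t₀) ≤ ½ ^ℚ j * G t₀
    decay zero = ℚₚ.≤-reflexive (sym (ℚₚ.*-identityˡ _))
    decay (suc j) = ℚₚ.≤-trans
      (subst (_≤ ½ * G (j ℕ.+ t₀)) (solve 1 (λ x → con ½ :* (x :+ x) := x) refl (G (suc j ℕ.+ t₀)))
        (*-monoˡ-≤ 0≤½ (halving (j ℕ.+ t₀) (ℕₚ.m≤n+m t₀ j))))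
      (subst (½ * G (j ℕ.+ t₀) ≤_) (sym (ℚₚ.*-assoc ½ (½ ^ℚ j) (G t₀))) (*-monoˡ-≤ 0≤½ (decay j)))

    conclude : ∃[ j ] ½ ^ℚ j * G t₀ ≤ η * ½ → ∃[ T ] ∀ J → sumFrom G T J ≤ η
    conclude (j , ½ʲ*G≤) = j ℕ.+ t₀ , λ J → ℚₚ.≤-trans (tail≤ J (j ℕ.+ t₀) (ℕₚ.m≤n+m t₀ j))
      (subst (_ ≤_) (halves η) (ℚₚ.+-mono-≤ G≤η/2 G≤η/2))
      where
      G≤η/2 = ℚₚ.≤-trans (decay j) ½ʲ*G≤

  dominated-sums-converge : ∀ (f : ℕ → ℕ → ℚ) (g G : ℕ → ℚ) →
    (∀ t n → 0ℚ ≤ f t n) → (∀ t n → f t n ≤ g t) → (∀ t → g t ≤ G t) →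
    SmallTails G → (∀ t → Limsup≤0 (λ n → g t - f t n)) →
    ∀ ε → 0ℚ < ε → ∃[ N ] ∃[ T₀ ] ∀ n T → N ℕ.≤ n → T₀ ℕ.≤ T →
      ∣ sumFrom (λ t → f t n) 0 n - sumFrom g 0 T ∣ < ε
  dominated-sums-converge f g G 0≤f f≤g g≤G tails g-f→0 ε 0<ε =
    conclude (tails η 0<η)
    where
    η = ε * ½ * ½
    0<η = half-pos (half-pos 0<ε)
    η≤2η : η ≤ η + η
    η≤2η = 0≤q-p⇒p≤q (subst (0ℚ ≤_) (solve 1 (λ x → x := (x :+ x) :- x) refl η) (ℚₚ.<⇒≤ 0<η))
    2η<ε : η + η < ε
    2η<ε = subst (_< ε) (sym (halves (ε * ½))) (0<q-p⇒p<q (subst (0ℚ <_)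
      (solve 1 (λ e → e :* con ½ := e :- e :* con ½) refl ε) (half-pos 0<ε)))

    module _ (T₁ : ℕ) (tail≤ : ∀ J → sumFrom G T₁ J ≤ η)
             (M : ℕ) (head≤ : ∀ n → M ℕ.≤ n → sumFrom (λ t → g t - f t n) 0 T₁ ≤ η)
             (n T : ℕ) (M+T₁≤n : M ℕ.+ T₁ ℕ.≤ n) (T₁≤T : T₁ ℕ.≤ T) where
      A = sumFrom (λ t → f t n) 0 T₁
      B = sumFrom (λ t → f t n) T₁ (n ∸ T₁)
      A′ = sumFrom g 0 T₁
      B′ = sumFrom g T₁ (T ∸ T₁)
      H = sumFrom (λ t → g t - f t n) 0 T₁

      X≡A+B : sumFrom (λ t → f t n) 0 n ≡ A + B
      X≡A+B = trans (cong (sumFrom (λ t → f t n) 0) (sym (ℕₚ.m+[n∸m]≡n (ℕₚ.≤-trans (ℕₚ.m≤n+m T₁ M) M+T₁≤n))))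
        (sumFrom-split (λ t → f t n) 0 T₁ (n ∸ T₁))

      Y≡A′+B′ : sumFrom g 0 T ≡ A′ + B′
      Y≡A′+B′ = trans (cong (sumFrom g 0) (sym (ℕₚ.m+[n∸m]≡n T₁≤T))) (sumFrom-split g 0 T₁ (T ∸ T₁))

      X-Y≡B-[B′+H] : sumFrom (λ t → f t n) 0 n - sumFrom g 0 T ≡ B - (B′ + H)
      X-Y≡B-[B′+H] = begin
        sumFrom (λ t → f t n) 0 n - sumFrom g 0 T ≡⟨ cong₂ _-_ X≡A+B Y≡A′+B′ ⟩
        (A + B) - (A′ + B′)
          ≡⟨ solve 4 (λ A B A′ B′ → (A :+ B) :- (A′ :+ B′) := B :- (B′ :+ (A′ :- A))) refl A B A′ B′ ⟩
        B - (B′ + (A′ - A))                         ≡⟨ cong (λ x → B - (B′ + x)) (sym (sumFrom-- g (λ t → f t n) 0 T₁)) ⟩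
        B - (B′ + H)                                ∎
        where open ≡-Reasoning

      close : ∣ sumFrom (λ t → f t n) 0 n - sumFrom g 0 T ∣ < ε
      close = subst (λ x → ∣ x ∣ < ε) (sym X-Y≡B-[B′+H]) (ℚₚ.≤-<-trans (∣p-q∣≤r
        (sumFrom-nonNeg T₁ (n ∸ T₁) (λ t → 0≤f t n))
        (ℚₚ.≤-trans (ℚₚ.≤-trans (sumFrom-mono-≤ T₁ (n ∸ T₁) (λ t → ℚₚ.≤-trans (f≤g t n) (g≤G t)))
                                (tail≤ (n ∸ T₁))) η≤2η)
        (+-nonNeg (sumFrom-nonNeg T₁ (T ∸ T₁) (λ t → ℚₚ.≤-trans (0≤f t n) (f≤g t n)))
                  (sumFrom-nonNeg 0 T₁ (λ t → p≤q⇒0≤q-p (f≤g t n))))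
        (ℚₚ.+-mono-≤ (ℚₚ.≤-trans (sumFrom-mono-≤ T₁ (T ∸ T₁) g≤G) (tail≤ (T ∸ T₁)))
                     (head≤ n (ℕₚ.≤-trans (ℕₚ.m≤m+n M T₁) M+T₁≤n)))) 2η<ε)

    conclude : ∃[ T₁ ] (∀ J → sumFrom G T₁ J ≤ η) → ∃[ N ] ∃[ T₀ ] ∀ n T → N ℕ.≤ n → T₀ ℕ.≤ T →
      ∣ sumFrom (λ t → f t n) 0 n - sumFrom g 0 T ∣ < ε
    conclude (T₁ , tail≤) = withHead (sumFrom-Limsup≤0 (λ t n → g t - f t n) 0 T₁ g-f→0 η 0<η)
      where
      withHead : ∃[ M ] (∀ n → M ℕ.≤ n → sumFrom (λ t → g t - f t n) 0 T₁ ≤ η) →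
        ∃[ N ] ∃[ T₀ ] ∀ n T → N ℕ.≤ n → T₀ ℕ.≤ T → ∣ sumFrom (λ t → f t n) 0 n - sumFrom g 0 T ∣ < ε
      withHead (M , head≤) = M ℕ.+ T₁ , T₁ , close T₁ tail≤ M head≤

  -- The recursion F t (n + t) = u t (F t n + F (t - 1) n)

  module Recurrence
    (u : ℕ → ℚ) (F : ℕ → ℕ → ℚ) (G : ℕ → ℚ)
    (0≤u : ∀ t → 0ℚ ≤ u t) (u<1 : ∀ t → u (suc (suc t)) < 1ℚ) (u₁≡1 : u 1 ≡ 1ℚ)
    (F₀₀≡1 : F 0 0 ≡ 1ℚ) (F₀-suc≡0 : ∀ n → F 0 (suc n) ≡ 0ℚ)
    (F-vanish : ∀ t n → n ℕ.< t → F t n ≡ 0ℚ)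
    (F-rec : ∀ t n → F (suc t) (n ℕ.+ suc t) ≡ u (suc t) * (F (suc t) n + F t n))
    (G₁≡1 : G 1 ≡ 1ℚ)
    (G-rec : ∀ t → G (suc (suc t)) ≡ u (suc (suc t)) * (G (suc (suc t)) + G (suc t)))
    where

    F₁≡1 : ∀ n → F 1 (suc n) ≡ 1ℚ
    F₁≡1 n = trans (cong (F 1) (ℕₚ.+-comm 1 n)) (trans (F-rec 0 n)
      (trans (cong (_* (F 1 n + F 0 n)) u₁≡1) (trans (ℚₚ.*-identityˡ _) (F₁+F₀≡1 n))))
      where
      F₁+F₀≡1 : ∀ n → F 1 n + F 0 n ≡ 1ℚ
      F₁+F₀≡1 zero = trans (cong₂ _+_ (F-vanish 1 0 (s≤s z≤n)) F₀₀≡1) (ℚₚ.+-identityˡ 1ℚ)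
      F₁+F₀≡1 (suc n) = trans (cong₂ _+_ (F₁≡1 n) (F₀-suc≡0 n)) (ℚₚ.+-identityʳ 1ℚ)

    0≤G : ∀ t → 0ℚ ≤ G (suc t)
    0≤G zero = subst (0ℚ ≤_) (sym G₁≡1) (ℚₚ.<⇒≤ (ℚₚ.positive⁻¹ 1ℚ))
    0≤G (suc t) = *-cancelʳ-≤ (p<q⇒0<q-p (u<1 t)) (subst₂ _≤_ (sym (ℚₚ.*-zeroˡ (1ℚ - U)))
      (sym (x≡u[x+y]⇒x[1-u]≡uy (G (suc (suc t))) U (G (suc t)) (G-rec t))) (*-nonNeg (0≤u _) (0≤G t)))
      where U = u (suc (suc t))

    F-bounds : ∀ t n → 0ℚ ≤ F (suc t) n × F (suc t) n ≤ G (suc t)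
    F-bounds zero zero = ℚₚ.≤-reflexive (sym (F-vanish 1 0 (s≤s z≤n))) ,
      subst (_≤ G 1) (sym (F-vanish 1 0 (s≤s z≤n))) (0≤G 0)
    F-bounds zero (suc n) = subst (0ℚ ≤_) (sym (F₁≡1 n)) (ℚₚ.<⇒≤ (ℚₚ.positive⁻¹ 1ℚ)) ,
      ℚₚ.≤-reflexive (trans (F₁≡1 n) (sym G₁≡1))
    F-bounds (suc t) = <-rec _ bound
      where
      bound : ∀ n → (∀ {m} → m ℕ.< n → 0ℚ ≤ F (suc (suc t)) m × F (suc (suc t)) m ≤ G (suc (suc t))) →
              0ℚ ≤ F (suc (suc t)) n × F (suc (suc t)) n ≤ G (suc (suc t))
      bound n below with n ℕₚ.<? suc (suc t)
      ... | yes n<t+2 = ℚₚ.≤-reflexive (sym (F-vanish _ n n<t+2)) ,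
        subst (_≤ G (suc (suc t))) (sym (F-vanish _ n n<t+2)) (0≤G (suc t))
      ... | no n≮t+2 = subst (λ n → 0ℚ ≤ F (suc (suc t)) n × F (suc (suc t)) n ≤ G (suc (suc t))) m+t+2≡n
        (subst (0ℚ ≤_) (sym (F-rec (suc t) m)) (*-nonNeg (0≤u _) (+-nonNeg (proj₁ IH) (proj₁ (F-bounds t m)))) ,
         subst₂ _≤_ (sym (F-rec (suc t) m)) (sym (G-rec t))
           (*-monoˡ-≤ (0≤u _) (ℚₚ.+-mono-≤ (proj₂ IH) (proj₂ (F-bounds t m)))))
        where
        m = n ∸ suc (suc t)
        m+t+2≡n : m ℕ.+ suc (suc t) ≡ n
        m+t+2≡n = ℕₚ.m∸n+n≡m (ℕₚ.≮⇒≥ n≮t+2)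
        IH = below (subst (m ℕ.<_) m+t+2≡n (ℕₚ.m<m+n m (s≤s z≤n)))

    G-F-rec : ∀ t n → G (suc (suc t)) - F (suc (suc t)) (n ℕ.+ suc (suc t))
                    ≡ u (suc (suc t)) * ((G (suc (suc t)) - F (suc (suc t)) n) + (G (suc t) - F (suc t) n))
    G-F-rec t n = begin
      G₂ - F (suc (suc t)) (n ℕ.+ suc (suc t)) ≡⟨ cong₂ _-_ (G-rec t) (F-rec (suc t) n) ⟩
      U * (G₂ + G₁) - U * (F₂ + F₁)
        ≡⟨ solve 5 (λ U a b c d → U :* (a :+ b) :- U :* (c :+ d) := U :* ((a :- c) :+ (b :- d))) refl U G₂ G₁ F₂ F₁ ⟩
      U * ((G₂ - F₂) + (G₁ - F₁))              ∎
      where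
      open ≡-Reasoning
      U = u (suc (suc t))
      G₂ = G (suc (suc t))
      G₁ = G (suc t)
      F₂ = F (suc (suc t)) n
      F₁ = F (suc t) n

    G-F≤G : ∀ t n → G (suc t) - F (suc t) n ≤ G (suc t)
    G-F≤G t n = 0≤q-p⇒p≤q (subst (0ℚ ≤_) (solve 2 (λ g f → f := g :- (g :- f)) refl (G (suc t)) (F (suc t) n))
      (proj₁ (F-bounds t n)))

    G-F→0 : ∀ t → Limsup≤0 (λ n → G (suc t) - F (suc t) n)
    G-F→0 zero δ 0<δ = 1 , λ { (suc n) _ →
      subst (_≤ δ) (sym (trans (cong₂ _-_ G₁≡1 (F₁≡1 n)) (ℚₚ.+-inverseʳ 1ℚ))) (ℚₚ.<⇒≤ 0<δ) }
    G-F→0 (suc t) = contraction-Limsup≤0 (suc t) (0≤u _) (u<1 t) (0≤G (suc t)) (G-F≤G (suc t))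
      (λ n → ℚₚ.≤-reflexive (G-F-rec t n)) (G-F→0 t)

    G-halving : ∀ t₀ → (∀ t → t₀ ℕ.≤ t → ℕ→ℚ 3 * u (suc (suc t)) ≤ 1ℚ) →
      ∀ t → t₀ ℕ.≤ t → G (suc (suc t)) + G (suc (suc t)) ≤ G (suc t)
    G-halving t₀ 3u≤1 t t₀≤t = *-cancelʳ-≤ (p<q⇒0<q-p (u<1 t)) (begin
      (G₂ + G₂) * (1ℚ - U)          ≡⟨ solve 2 (λ x y → (x :+ x) :* y := x :* y :+ x :* y) refl G₂ (1ℚ - U) ⟩
      G₂ * (1ℚ - U) + G₂ * (1ℚ - U)  ≡⟨ cong (λ x → x + x) G₂[1-U]≡UG₁ ⟩
      U * G₁ + U * G₁                ≤⟨ 0≤q-p⇒p≤q (subst (0ℚ ≤_) slack (*-nonNeg (p≤q⇒0≤q-p (3u≤1 t t₀≤t)) (0≤G t))) ⟩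
      G₁ * (1ℚ - U)                  ∎)
      where
      open ℚₚ.≤-Reasoning
      U = u (suc (suc t))
      G₂ = G (suc (suc t))
      G₁ = G (suc t)
      G₂[1-U]≡UG₁ = x≡u[x+y]⇒x[1-u]≡uy G₂ U G₁ (G-rec t)
      slack : (1ℚ - ℕ→ℚ 3 * U) * G₁ ≡ G₁ * (1ℚ - U) - (U * G₁ + U * G₁)
      slack = solve 2 (λ U g → (con 1ℚ :- con (ℕ→ℚ 3) :* U) :* g := g :* (con 1ℚ :- U) :- (U :* g :+ U :* g)) refl U G₁

    weighted-sums-converge : ∀ (c : ℕ → ℚ) → (∀ t → 0ℚ ≤ c t) → (∀ t → c t ≤ 1ℚ) →
      ∀ t₀ → (∀ t → t₀ ℕ.≤ t → ℕ→ℚ 3 * u (suc (suc t)) ≤ 1ℚ) →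
      ∀ ε → 0ℚ < ε → ∃[ N ] ∃[ T₀ ] ∀ n T → N ℕ.≤ n → T₀ ℕ.≤ T →
        ∣ sumFrom (λ t → c t * F (suc t) n) 0 n - sumFrom (λ t → c t * G (suc t)) 0 T ∣ < ε
    weighted-sums-converge c 0≤c c≤1 t₀ 3u≤1 = dominated-sums-converge
      (λ t n → c t * F (suc t) n) (λ t → c t * G (suc t)) (λ t → G (suc t))
      (λ t n → *-nonNeg (0≤c t) (proj₁ (F-bounds t n)))
      (λ t n → *-monoˡ-≤ (0≤c t) (proj₂ (F-bounds t n)))
      (λ t → subst (c t * G (suc t) ≤_) (ℚₚ.*-identityˡ _) (*-monoʳ-≤ (0≤G t) (c≤1 t)))
      (halving⇒SmallTails t₀ 0≤G (G-halving t₀ 3u≤1))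
      (λ t → Limsup≤0-mono (cG-cF≤G-F t) (G-F→0 t))
      where
      cG-cF≤G-F : ∀ t n → c t * G (suc t) - c t * F (suc t) n ≤ G (suc t) - F (suc t) n
      cG-cF≤G-F t n = subst (_≤ G (suc t) - F (suc t) n)
        (solve 3 (λ c g f → c :* (g :- f) := c :* g :- c :* f) refl (c t) (G (suc t)) (F (suc t) n))
        (subst (c t * (G (suc t) - F (suc t) n) ≤_) (ℚₚ.*-identityˡ _)
          (*-monoʳ-≤ (p≤q⇒0≤q-p (proj₂ (F-bounds t n))) (c≤1 t)))

  -- Weighted partitions into distinct parts

  sumℚ-++ : ∀ xs ys → sumℚ (xs ++ ys) ≡ sumℚ xs + sumℚ ys
  sumℚ-++ [] ys = sym (ℚₚ.+-identityˡ _)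
  sumℚ-++ (x ∷ xs) ys = trans (cong (x +_) (sumℚ-++ xs ys)) (sym (ℚₚ.+-assoc x _ _))

  sumℚ-map-*ˡ : ∀ {A : Set} c (f : A → ℚ) xs → sumℚ (map (λ a → c * f a) xs) ≡ c * sumℚ (map f xs)
  sumℚ-map-*ˡ c f [] = sym (ℚₚ.*-zeroʳ c)
  sumℚ-map-*ˡ c f (x ∷ xs) = trans (cong (c * f x +_) (sumℚ-map-*ˡ c f xs)) (sym (ℚₚ.*-distribˡ-+ c _ _))

  distinctParts-fits : ∀ m n → suc m ℕ.≤ n →
    distinctParts (suc m) n ≡ distinctParts m n ++ map (suc m ∷_) (distinctParts m (n ∸ suc m))
  distinctParts-fits m n m<n with suc m ℕₚ.≤? n
  ... | yes _ = refl
  ... | no m≮n = contradiction m<n m≮n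

  distinctParts-too-big : ∀ m n → ¬ suc m ℕ.≤ n → distinctParts (suc m) n ≡ distinctParts m n
  distinctParts-too-big m n m≮n with suc m ℕₚ.≤? n
  ... | yes m<n = contradiction m<n m≮n
  ... | no _ = refl

  [a+1+m]+[1+t]≡[a+t]+[2+m] : ∀ a m t → a ℕ.+ suc m ℕ.+ suc t ≡ a ℕ.+ t ℕ.+ suc (suc m)
  [a+1+m]+[1+t]≡[a+t]+[2+m] = solve-∀

  module _ (r : ℕ → ℚ) where

    weight : ℕ → List ℕ → ℚ
    weight i [] = 1ℚ
    weight i (p ∷ ps) = r i ^ℚ p * weight (suc i) ps

    prodFrom : ℕ → ℕ → ℚ
    prodFrom i zero = 1ℚ
    prodFrom i (suc t) = r i * prodFrom (suc i) t

    -- Σ of ∏ⱼ r (i + j - 1) ^ pⱼ over p₁ > ⋯ > pₜ ≥ 1 with p₁ ≤ m and p₁ + ⋯ + pₜ = n,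
    -- by recursion on the largest part as in distinctParts
    partitionWeight : ℕ → ℕ → ℕ → ℕ → ℚ
    partitionWeight i zero m zero = 1ℚ
    partitionWeight i zero m (suc n) = 0ℚ
    partitionWeight i (suc t) zero n = 0ℚ
    partitionWeight i (suc t) (suc m) n with suc m ℕₚ.≤? n
    ... | yes _ = partitionWeight i (suc t) m n + r i ^ℚ suc m * partitionWeight (suc i) t m (n ∸ suc m)
    ... | no _  = partitionWeight i (suc t) m n

    partitionWeight-fits : ∀ i t m n → suc m ℕ.≤ n → partitionWeight i (suc t) (suc m) n
      ≡ partitionWeight i (suc t) m n + r i ^ℚ suc m * partitionWeight (suc i) t m (n ∸ suc m)
    partitionWeight-fits i t m n m<n with suc m ℕₚ.≤? n
    ... | yes _ = refl
    ... | no m≮n = contradiction m<n m≮n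

    partitionWeight-too-big : ∀ i t m n → ¬ suc m ℕ.≤ n → partitionWeight i t (suc m) n ≡ partitionWeight i t m n
    partitionWeight-too-big i zero m zero _ = refl
    partitionWeight-too-big i zero m (suc n) _ = refl
    partitionWeight-too-big i (suc t) m n m≮n with suc m ℕₚ.≤? n
    ... | yes m<n = contradiction m<n m≮n
    ... | no _ = refl

    partitionWeight-no-parts : ∀ i j m k n → partitionWeight i zero m n ≡ partitionWeight j zero k n
    partitionWeight-no-parts i j m k zero = refl
    partitionWeight-no-parts i j m k (suc n) = refl

    sum-by-length : ∀ (h : ℕ → ℚ) i m K → m ℕ.≤ K → ∀ n →
      sumℚ (map (λ ps → h (length ps) * weight i ps) (distinctParts m n))
        ≡ sumFrom (λ t → h t * partitionWeight i t m n) 0 (suc K)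
    sum-by-length h i zero K _ zero = cong (h 0 * 1ℚ +_) (sym (no-parts-fit K))
      where
      no-parts-fit : ∀ K → sumFrom (λ t → h t * partitionWeight i t 0 0) 1 K ≡ 0ℚ
      no-parts-fit K = trans (sumFrom-shift _ 0 K) (sumFrom-zero 0 K (λ t → ℚₚ.*-zeroʳ (h (suc t))))
    sum-by-length h i zero K _ (suc n) = sym (trans (cong₂ _+_ (ℚₚ.*-zeroʳ (h 0))
      (trans (sumFrom-shift _ 0 K) (sumFrom-zero 0 K (λ t → ℚₚ.*-zeroʳ (h (suc t)))))) (ℚₚ.+-identityˡ 0ℚ))
    sum-by-length h i (suc m) (suc K) (s≤s m≤K) n = by-cases (suc m ℕₚ.≤? n)
      where
      term = λ ps → h (length ps) * weight i ps
      f₁ = λ t → h t * partitionWeight i t (suc m) n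
      by-cases : Dec (suc m ℕ.≤ n) → sumℚ (map term (distinctParts (suc m) n)) ≡ sumFrom f₁ 0 (suc (suc K))
      by-cases (no m≮n) = begin
        sumℚ (map term (distinctParts (suc m) n))  ≡⟨ cong (λ xs → sumℚ (map term xs)) (distinctParts-too-big m n m≮n) ⟩
        sumℚ (map term (distinctParts m n))        ≡⟨ sum-by-length h i m (suc K) (ℕₚ.m≤n⇒m≤1+n m≤K) n ⟩
        sumFrom (λ t → h t * partitionWeight i t m n) 0 (suc (suc K))
          ≡⟨ sumFrom-cong 0 (suc (suc K)) (λ t → cong (h t *_) (sym (partitionWeight-too-big i t m n m≮n))) ⟩
        sumFrom (λ t → h t * partitionWeight i t (suc m) n) 0 (suc (suc K)) ∎
          where open ≡-Reasoning
      by-cases (yes m<n) = begin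
        sumℚ (map term (distinctParts (suc m) n))
          ≡⟨ cong (λ xs → sumℚ (map term xs)) (distinctParts-fits m n m<n) ⟩
        sumℚ (map term (distinctParts m n ++ map (suc m ∷_) rest))
          ≡⟨ trans (cong sumℚ (Listₚ.map-++ term (distinctParts m n) _)) (sumℚ-++ (map term (distinctParts m n)) _) ⟩
        sumℚ (map term (distinctParts m n)) + sumℚ (map term (map (suc m ∷_) rest))
          ≡⟨ cong (sumℚ (map term (distinctParts m n)) +_) (trans (cong sumℚ (trans (sym (Listₚ.map-∘ rest))
               (Listₚ.map-cong (λ ps → solve 3 (λ x y z → x :* (y :* z) := y :* (x :* z)) refl
                 (h (suc (length ps))) c (weight (suc i) ps)) rest))) (sumℚ-map-*ˡ c term′ rest)) ⟩
        sumℚ (map term (distinctParts m n)) + c * sumℚ (map term′ rest)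
          ≡⟨ cong₂ (λ x y → x + c * y) (sum-by-length h i m (suc K) (ℕₚ.m≤n⇒m≤1+n m≤K) n)
                                        (sum-by-length (λ t → h (suc t)) (suc i) m K m≤K (n ∸ suc m)) ⟩
        (h 0 * partitionWeight i 0 m n + sumFrom f₀ 1 (suc K)) + c * sumFrom g 0 (suc K)
          ≡⟨ cong (λ x → (h 0 * partitionWeight i 0 m n + x) + c * sumFrom g 0 (suc K)) (sumFrom-shift f₀ 0 (suc K)) ⟩
        (h 0 * partitionWeight i 0 m n + sumFrom (λ t → f₀ (suc t)) 0 (suc K)) + c * sumFrom g 0 (suc K)
          ≡⟨ solve 3 (λ x y z → (x :+ y) :+ z := x :+ (y :+ z)) refl (h 0 * partitionWeight i 0 m n) _ _ ⟩
        h 0 * partitionWeight i 0 m n + (sumFrom (λ t → f₀ (suc t)) 0 (suc K) + c * sumFrom g 0 (suc K))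
          ≡⟨ cong₂ _+_ (cong (h 0 *_) (partitionWeight-no-parts i i m (suc m) n))
               (sym (trans (sumFrom-+ (λ t → f₀ (suc t)) (λ t → c * g t) 0 (suc K))
                           (cong (sumFrom (λ t → f₀ (suc t)) 0 (suc K) +_) (sumFrom-*ˡ c g 0 (suc K))))) ⟩
        h 0 * partitionWeight i 0 (suc m) n + sumFrom (λ t → f₀ (suc t) + c * g t) 0 (suc K)
          ≡⟨ cong (h 0 * partitionWeight i 0 (suc m) n +_) (trans (sumFrom-cong 0 (suc K) (λ t →
               trans (solve 4 (λ x y z w → x :* y :+ z :* (x :* w) := x :* (y :+ z :* w)) refl
                       (h (suc t)) (partitionWeight i (suc t) m n) c (partitionWeight (suc i) t m (n ∸ suc m)))
                     (cong (h (suc t) *_) (sym (partitionWeight-fits i t m n m<n)))))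
               (sym (sumFrom-shift f₁ 0 (suc K)))) ⟩
        sumFrom f₁ 0 (suc (suc K)) ∎
          where
          open ≡-Reasoning
          term′ = λ ps → h (suc (length ps)) * weight (suc i) ps
          rest = distinctParts m (n ∸ suc m)
          c = r i ^ℚ suc m
          f₀ = λ t → h t * partitionWeight i t m n
          g = λ t → h (suc t) * partitionWeight (suc i) t m (n ∸ suc m)

    partitionWeight-vanish : ∀ i t m n → n ℕ.< t → partitionWeight i t m n ≡ 0ℚ
    partitionWeight-vanish i (suc t) zero n _ = refl
    partitionWeight-vanish i (suc t) (suc m) n n<1+t = by-cases (suc m ℕₚ.≤? n)
      where
      by-cases : Dec (suc m ℕ.≤ n) → partitionWeight i (suc t) (suc m) n ≡ 0ℚ
      by-cases (no m≮n) = trans (partitionWeight-too-big i (suc t) m n m≮n) (partitionWeight-vanish i (suc t) m n n<1+t)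
      by-cases (yes m<n) = trans (partitionWeight-fits i t m n m<n)
        (trans (cong₂ (λ x y → x + r i ^ℚ suc m * y)
                 (partitionWeight-vanish i (suc t) m n n<1+t) (partitionWeight-vanish (suc i) t m (n ∸ suc m) rest<t))
               (solve 1 (λ c → con 0ℚ :+ c :* con 0ℚ := con 0ℚ) refl (r i ^ℚ suc m)))
        where
        rest<t : n ∸ suc m ℕ.< t
        rest<t = ℕₚ.<-≤-trans (subst (n ∸ suc m ℕ.<_) (ℕₚ.m∸n+n≡m m<n) (ℕₚ.m<m+n (n ∸ suc m) (s≤s z≤n))) (ℕₚ.≤-pred n<1+t)

    partitionWeight-stable : ∀ i t j n → partitionWeight i t (j ℕ.+ n) n ≡ partitionWeight i t n n
    partitionWeight-stable i t zero n = refl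
    partitionWeight-stable i t (suc j) n =
      trans (partitionWeight-too-big i t (j ℕ.+ n) n (ℕₚ.≤⇒≯ (ℕₚ.m≤n+m n j))) (partitionWeight-stable i t j n)

    -- Subtracting 1 from every part turns a partition of n + t + 1 into t + 1 distinct parts
    -- into one of n into t + 1 parts, or into t parts once the part 0 is dropped.
    ShiftIdentity : ℕ → ℕ → ℕ → ℕ → Set
    ShiftIdentity m i t n = partitionWeight i (suc t) (suc m) (n ℕ.+ suc t)
      ≡ prodFrom i (suc t) * (partitionWeight i (suc t) m n + partitionWeight i t m n)

    shift-base : ∀ i t n → ShiftIdentity 0 i t n
    shift-base i t n = trans (partitionWeight-fits i t 0 (n ℕ.+ suc t) (subst (1 ℕ.≤_) (sym (ℕₚ.+-suc n t)) (s≤s z≤n)))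
      (trans (cong (λ k → 0ℚ + r i ^ℚ 1 * partitionWeight (suc i) t 0 k) (cong (_∸ 1) (ℕₚ.+-suc n t))) (close t))
      where
      close : ∀ t → 0ℚ + r i ^ℚ 1 * partitionWeight (suc i) t 0 (n ℕ.+ t)
                  ≡ prodFrom i (suc t) * (partitionWeight i (suc t) 0 n + partitionWeight i t 0 n)
      close zero = trans (cong (λ x → 0ℚ + r i ^ℚ 1 * x)
          (trans (cong (partitionWeight (suc i) 0 0) (ℕₚ.+-identityʳ n)) (partitionWeight-no-parts (suc i) i 0 0 n)))
        (solve 2 (λ ri x → con 0ℚ :+ (ri :* con 1ℚ) :* x := (ri :* con 1ℚ) :* (con 0ℚ :+ x)) refl (r i) (partitionWeight i 0 0 n))
      close (suc t) = solve 2 (λ ri R → con 0ℚ :+ (ri :* con 1ℚ) :* con 0ℚ := (ri :* R) :* (con 0ℚ :+ con 0ℚ))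
        refl (r i) (prodFrom (suc i) (suc t))

    shift-step-fits : ∀ m i t a → (∀ i t n → ShiftIdentity m i t n) → ShiftIdentity (suc m) i t (a ℕ.+ suc m)
    shift-step-fits m i t a IH = trans (partitionWeight-fits i t (suc m) N m+2≤N)
      (trans (cong₂ (λ x k → x + r i ^ℚ suc (suc m) * partitionWeight (suc i) t (suc m) k) (IH i t n) N-m-2≡a+t)
             (close t))
      where
      n = a ℕ.+ suc m
      N = n ℕ.+ suc t
      P = r i ^ℚ suc m
      m+2≤N : suc (suc m) ℕ.≤ N
      m+2≤N = subst (suc (suc m) ℕ.≤_) (sym (ℕₚ.+-suc n t)) (s≤s (ℕₚ.≤-trans (ℕₚ.m≤n+m (suc m) a) (ℕₚ.m≤m+n n t)))
      N-m-2≡a+t : N ∸ suc (suc m) ≡ a ℕ.+ t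
      N-m-2≡a+t = trans (cong (_∸ suc (suc m)) ([a+1+m]+[1+t]≡[a+t]+[2+m] a m t)) (ℕₚ.m+n∸n≡m (a ℕ.+ t) (suc (suc m)))
      m<n = ℕₚ.m≤n+m (suc m) a
      n-m-1≡a = ℕₚ.m+n∸n≡m a (suc m)
      fits : ∀ t → partitionWeight i (suc t) (suc m) n ≡ partitionWeight i (suc t) m n + P * partitionWeight (suc i) t m a
      fits t = trans (partitionWeight-fits i t m n m<n) (cong (λ k → partitionWeight i (suc t) m n + P * partitionWeight (suc i) t m k) n-m-1≡a)
      close : ∀ t → prodFrom i (suc t) * (partitionWeight i (suc t) m n + partitionWeight i t m n)
                      + r i ^ℚ suc (suc m) * partitionWeight (suc i) t (suc m) (a ℕ.+ t)
                  ≡ prodFrom i (suc t) * (partitionWeight i (suc t) (suc m) n + partitionWeight i t (suc m) n)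
      close zero = begin
        (r i * 1ℚ) * (X₁ + X₀) + (r i * P) * partitionWeight (suc i) 0 (suc m) (a ℕ.+ 0)
          ≡⟨ cong (λ z → (r i * 1ℚ) * (X₁ + X₀) + (r i * P) * z)
               (trans (cong (partitionWeight (suc i) 0 (suc m)) (ℕₚ.+-identityʳ a)) (partitionWeight-no-parts (suc i) (suc i) (suc m) m a)) ⟩
        (r i * 1ℚ) * (X₁ + X₀) + (r i * P) * Z₀
          ≡⟨ solve 5 (λ ri X₁ X₀ P Z₀ → (ri :* con 1ℚ) :* (X₁ :+ X₀) :+ (ri :* P) :* Z₀ := (ri :* con 1ℚ) :* ((X₁ :+ P :* Z₀) :+ X₀))
               refl (r i) X₁ X₀ P Z₀ ⟩
        (r i * 1ℚ) * ((X₁ + P * Z₀) + X₀)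
          ≡⟨ cong₂ (λ x y → (r i * 1ℚ) * (x + y)) (sym (fits 0)) (partitionWeight-no-parts i i m (suc m) n) ⟩
        (r i * 1ℚ) * (partitionWeight i 1 (suc m) n + partitionWeight i 0 (suc m) n) ∎
        where
        open ≡-Reasoning
        X₁ = partitionWeight i 1 m n
        X₀ = partitionWeight i 0 m n
        Z₀ = partitionWeight (suc i) 0 m a
      close (suc t) = begin
        (r i * R) * (X₁ + X₀) + (r i * P) * partitionWeight (suc i) (suc t) (suc m) (a ℕ.+ suc t)
          ≡⟨ cong (λ z → (r i * R) * (X₁ + X₀) + (r i * P) * z) (IH (suc i) t a) ⟩
        (r i * R) * (X₁ + X₀) + (r i * P) * (R * (Z₁ + Z₀))
          ≡⟨ solve 7 (λ ri R X₁ X₀ P Z₁ Z₀ → (ri :* R) :* (X₁ :+ X₀) :+ (ri :* P) :* (R :* (Z₁ :+ Z₀))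
                                          := (ri :* R) :* ((X₁ :+ P :* Z₁) :+ (X₀ :+ P :* Z₀)))
               refl (r i) R X₁ X₀ P Z₁ Z₀ ⟩
        (r i * R) * ((X₁ + P * Z₁) + (X₀ + P * Z₀))
          ≡⟨ cong₂ (λ x y → (r i * R) * (x + y)) (sym (fits (suc t))) (sym (fits t)) ⟩
        (r i * R) * (partitionWeight i (suc (suc t)) (suc m) n + partitionWeight i (suc t) (suc m) n) ∎
        where
        open ≡-Reasoning
        R = prodFrom (suc i) (suc t)
        X₁ = partitionWeight i (suc (suc t)) m n
        X₀ = partitionWeight i (suc t) m n
        Z₁ = partitionWeight (suc i) (suc t) m a
        Z₀ = partitionWeight (suc i) t m a

    shift-step-too-big : ∀ m i t n → (∀ i t n → ShiftIdentity m i t n) → ¬ suc m ℕ.≤ n → ShiftIdentity (suc m) i t n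
    shift-step-too-big m i t n IH m≮n = trans (by-cases (suc (suc m) ℕₚ.≤? N))
      (cong₂ (λ x y → prodFrom i (suc t) * (x + y))
        (sym (partitionWeight-too-big i (suc t) m n m≮n)) (sym (partitionWeight-too-big i t m n m≮n)))
      where
      N = n ℕ.+ suc t
      by-cases : Dec (suc (suc m) ℕ.≤ N) → partitionWeight i (suc t) (suc (suc m)) N
                   ≡ prodFrom i (suc t) * (partitionWeight i (suc t) m n + partitionWeight i t m n)
      by-cases (no m+1≮N) = trans (partitionWeight-too-big i (suc t) (suc m) N m+1≮N) (IH i t n)
      by-cases (yes m+2≤N) = trans (partitionWeight-fits i t (suc m) N m+2≤N)
        (trans (cong₂ (λ x y → x + r i ^ℚ suc (suc m) * y) (IH i t n) (partitionWeight-vanish (suc i) t (suc m) _ rest<t))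
               (solve 2 (λ x c → x :+ c :* con 0ℚ := x) refl _ (r i ^ℚ suc (suc m))))
        where
        rest<t : N ∸ suc (suc m) ℕ.< t
        rest<t = ℕₚ.+-cancelʳ-< (suc (suc m)) (N ∸ suc (suc m)) t (subst₂ ℕ._<_ (sym (ℕₚ.m∸n+n≡m m+2≤N)) (sym (ℕₚ.+-suc t (suc m)))
          (s≤s (subst (ℕ._≤ t ℕ.+ suc m) (sym (ℕₚ.+-suc n t)) (subst (suc (n ℕ.+ t) ℕ.≤_) (ℕₚ.+-comm (suc m) t)
            (s≤s (ℕₚ.+-monoˡ-≤ t (ℕₚ.≮⇒≥ (λ n>m → m≮n n>m))))))))

    shift-identity : ∀ m i t n → ShiftIdentity m i t n
    shift-identity zero = shift-base
    shift-identity (suc m) i t n = by-cases (suc m ℕₚ.≤? n)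
      where
      by-cases : Dec (suc m ℕ.≤ n) → ShiftIdentity (suc m) i t n
      by-cases (yes m<n) = subst (ShiftIdentity (suc m) i t) (ℕₚ.m∸n+n≡m m<n)
        (shift-step-fits m i t (n ∸ suc m) (shift-identity m))
      by-cases (no m≮n) = shift-step-too-big m i t n (shift-identity m) m≮n

  βP[t+1+β]+tP≡[1+β]P[t+β] : ∀ β t P → β ℕ.* P ℕ.* (suc t ℕ.+ β) ℕ.+ t ℕ.* P ≡ suc β ℕ.* (P ℕ.* (t ℕ.+ β))
  βP[t+1+β]+tP≡[1+β]P[t+β] = solve-∀

  βᵗ⁺¹[t+1+β]+tβᵗ≡[1+β]βᵗ[t+β] : ∀ β t →
    β ℕ.^ suc t ℕ.* (suc t ℕ.+ β) ℕ.+ t ℕ.* β ℕ.^ t ≡ suc β ℕ.* (β ℕ.^ t ℕ.* (t ℕ.+ β))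
  βᵗ⁺¹[t+1+β]+tβᵗ≡[1+β]βᵗ[t+β] β t = βP[t+1+β]+tP≡[1+β]P[t+β] β t (β ℕ.^ t)

  [1+β]β[1+β]ᵗ≡β[1+β]ᵗ⁺¹ : ∀ β t → suc β ℕ.* (β ℕ.* suc β ℕ.^ t) ≡ β ℕ.* suc β ℕ.^ suc t
  [1+β]β[1+β]ᵗ≡β[1+β]ᵗ⁺¹ β t = xyz≡yxz (suc β) β (suc β ℕ.^ t)
    where
    xyz≡yxz : ∀ x y z → x ℕ.* (y ℕ.* z) ≡ y ℕ.* (x ℕ.* z)
    xyz≡yxz = solve-∀

  βᵗ[t+β]≤β[1+β]ᵗ : ∀ β t → β ℕ.^ t ℕ.* (t ℕ.+ β) ℕ.≤ β ℕ.* suc β ℕ.^ t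
  βᵗ[t+β]≤β[1+β]ᵗ β zero = ℕₚ.≤-reflexive (trans (ℕₚ.*-identityˡ β) (sym (ℕₚ.*-identityʳ β)))
  βᵗ[t+β]≤β[1+β]ᵗ β (suc t) = ℕₚ.≤-trans (ℕₚ.m≤m+n _ (t ℕ.* β ℕ.^ t))
    (subst₂ ℕ._≤_ (sym (βᵗ⁺¹[t+1+β]+tβᵗ≡[1+β]βᵗ[t+β] β t)) ([1+β]β[1+β]ᵗ≡β[1+β]ᵗ⁺¹ β t)
      (ℕₚ.*-monoʳ-≤ (suc β) (βᵗ[t+β]≤β[1+β]ᵗ β t)))

  βᵗ[t+β]<β[1+β]ᵗ : ∀ k t → suc k ℕ.^ suc (suc t) ℕ.* (suc (suc t) ℕ.+ suc k) ℕ.< suc k ℕ.* suc (suc k) ℕ.^ suc (suc t)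
  βᵗ[t+β]<β[1+β]ᵗ k t = ℕₚ.<-≤-trans (ℕₚ.m<m+n _ 0<[1+t]βᵗ⁺¹)
    (subst₂ ℕ._≤_ (sym (βᵗ⁺¹[t+1+β]+tβᵗ≡[1+β]βᵗ[t+β] β (suc t))) ([1+β]β[1+β]ᵗ≡β[1+β]ᵗ⁺¹ β (suc t))
      (ℕₚ.*-monoʳ-≤ (suc β) (βᵗ[t+β]≤β[1+β]ᵗ β (suc t))))
    where
    β = suc k
    0<[1+t]βᵗ⁺¹ : 0 ℕ.< suc t ℕ.* β ℕ.^ suc t
    0<[1+t]βᵗ⁺¹ = ℕₚ.*-mono-≤ {1} {suc t} {1} (s≤s z≤n) (ℕₚ.m^n>0 β (suc t))

  3βᵗ[t+β]≤β[1+β]ᵗ-step : ∀ β t → 3 ℕ.* (β ℕ.^ t ℕ.* (t ℕ.+ β)) ℕ.≤ β ℕ.* suc β ℕ.^ t →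
    3 ℕ.* (β ℕ.^ suc t ℕ.* (suc t ℕ.+ β)) ℕ.≤ β ℕ.* suc β ℕ.^ suc t
  3βᵗ[t+β]≤β[1+β]ᵗ-step β t 3V≤W =
    ℕₚ.≤-trans (ℕₚ.*-monoʳ-≤ 3 (ℕₚ.m≤m+n (β ℕ.^ suc t ℕ.* (suc t ℕ.+ β)) (t ℕ.* β ℕ.^ t)))
    (subst₂ ℕ._≤_ (sym (trans (cong (3 ℕ.*_) (βᵗ⁺¹[t+1+β]+tβᵗ≡[1+β]βᵗ[t+β] β t))
                              (xyz≡yxz 3 (suc β) (β ℕ.^ t ℕ.* (t ℕ.+ β)))))
      ([1+β]β[1+β]ᵗ≡β[1+β]ᵗ⁺¹ β t) (ℕₚ.*-monoʳ-≤ (suc β) 3V≤W))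
    where
    xyz≡yxz : ∀ x y z → x ℕ.* (y ℕ.* z) ≡ y ℕ.* (x ℕ.* z)
    xyz≡yxz = solve-∀

  [6β]²≡3[11β]β+3β² : ∀ β →
    (5 ℕ.* β ℕ.+ β) ℕ.* (5 ℕ.* β ℕ.+ β) ≡ 3 ℕ.* ((5 ℕ.* β ℕ.+ 5 ℕ.* β ℕ.+ β) ℕ.* β) ℕ.+ 3 ℕ.* (β ℕ.* β)
  [6β]²≡3[11β]β+3β² = solve-∀

  -- The square of βˢ (s + β) ≤ β (1 + β)ˢ at s = 5β, since (6β)² ≥ 3 · 11β · β.
  3βᵗ[t+β]≤β[1+β]ᵗ-base : ∀ k → let β = suc k; t = 5 ℕ.* β ℕ.+ 5 ℕ.* β in
    3 ℕ.* (β ℕ.^ t ℕ.* (t ℕ.+ β)) ℕ.≤ β ℕ.* suc β ℕ.^ t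
  3βᵗ[t+β]≤β[1+β]ᵗ-base k = ℕₚ.*-cancelˡ-≤ β (begin
    β ℕ.* (3 ℕ.* (β ℕ.^ (s ℕ.+ s) ℕ.* (s ℕ.+ s ℕ.+ β)))
      ≡⟨ rearrange₁ β (β ℕ.^ (s ℕ.+ s)) (s ℕ.+ s ℕ.+ β) ⟩
    β ℕ.^ (s ℕ.+ s) ℕ.* (3 ℕ.* ((s ℕ.+ s ℕ.+ β) ℕ.* β))
      ≤⟨ ℕₚ.*-monoʳ-≤ (β ℕ.^ (s ℕ.+ s)) (subst (3 ℕ.* ((s ℕ.+ s ℕ.+ β) ℕ.* β) ℕ.≤_) (sym ([6β]²≡3[11β]β+3β² β))
                                                (ℕₚ.m≤m+n _ (3 ℕ.* (β ℕ.* β)))) ⟩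
    β ℕ.^ (s ℕ.+ s) ℕ.* ((s ℕ.+ β) ℕ.* (s ℕ.+ β))
      ≡⟨ trans (cong (ℕ._* ((s ℕ.+ β) ℕ.* (s ℕ.+ β))) (ℕₚ.^-distribˡ-+-* β s s))
               (rearrange₂ (β ℕ.^ s) (β ℕ.^ s) (s ℕ.+ β) (s ℕ.+ β)) ⟩
    (β ℕ.^ s ℕ.* (s ℕ.+ β)) ℕ.* (β ℕ.^ s ℕ.* (s ℕ.+ β))
      ≤⟨ ℕₚ.*-mono-≤ (βᵗ[t+β]≤β[1+β]ᵗ β s) (βᵗ[t+β]≤β[1+β]ᵗ β s) ⟩
    (β ℕ.* suc β ℕ.^ s) ℕ.* (β ℕ.* suc β ℕ.^ s)
      ≡⟨ trans (rearrange₂ β (suc β ℕ.^ s) β (suc β ℕ.^ s)) (cong (λ x → β ℕ.* β ℕ.* x) (sym (ℕₚ.^-distribˡ-+-* (suc β) s s))) ⟩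
    β ℕ.* β ℕ.* suc β ℕ.^ (s ℕ.+ s)
      ≡⟨ ℕₚ.*-assoc β β _ ⟩
    β ℕ.* (β ℕ.* suc β ℕ.^ (s ℕ.+ s)) ∎)
    where
    open ℕₚ.≤-Reasoning
    β = suc k
    s = 5 ℕ.* β
    rearrange₁ : ∀ b P x → b ℕ.* (3 ℕ.* (P ℕ.* x)) ≡ P ℕ.* (3 ℕ.* (x ℕ.* b))
    rearrange₁ = solve-∀
    rearrange₂ : ∀ P Q x y → P ℕ.* Q ℕ.* (x ℕ.* y) ≡ (P ℕ.* x) ℕ.* (Q ℕ.* y)
    rearrange₂ = solve-∀

  3βᵗ[t+β]≤β[1+β]ᵗ-eventually : ∀ k j → let β = suc k; t = j ℕ.+ (5 ℕ.* β ℕ.+ 5 ℕ.* β) in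
    3 ℕ.* (β ℕ.^ t ℕ.* (t ℕ.+ β)) ℕ.≤ β ℕ.* suc β ℕ.^ t
  3βᵗ[t+β]≤β[1+β]ᵗ-eventually k zero = 3βᵗ[t+β]≤β[1+β]ᵗ-base k
  3βᵗ[t+β]≤β[1+β]ᵗ-eventually k (suc j) =
    3βᵗ[t+β]≤β[1+β]ᵗ-step (suc k) (j ℕ.+ (5 ℕ.* suc k ℕ.+ 5 ℕ.* suc k)) (3βᵗ[t+β]≤β[1+β]ᵗ-eventually k j)

  nCk-absorption : ∀ n k → suc k ℕ.* (suc n C suc k) ≡ suc n ℕ.* (n C k)
  nCk-absorption zero zero = refl
  nCk-absorption zero (suc k) = ℕₚ.*-zeroʳ (suc (suc k))
  nCk-absorption (suc n) zero = trans (ℕₚ.*-identityˡ _) (trans (nC1≡n (suc (suc n))) (sym (ℕₚ.*-identityʳ (suc (suc n)))))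
  nCk-absorption (suc n) (suc k) = begin
    suc (suc k) ℕ.* (suc (suc n) C suc (suc k))
      ≡⟨ cong (suc (suc k) ℕ.*_) (sym (nCk+nC[k+1]≡[n+1]C[k+1] (suc n) (suc k))) ⟩
    suc (suc k) ℕ.* (suc n C suc k ℕ.+ suc n C suc (suc k))
      ≡⟨ split k (suc n C suc k) (suc n C suc (suc k)) ⟩
    suc k ℕ.* (suc n C suc k) ℕ.+ suc n C suc k ℕ.+ suc (suc k) ℕ.* (suc n C suc (suc k))
      ≡⟨ cong₂ (λ x y → x ℕ.+ suc n C suc k ℕ.+ y) (nCk-absorption n k) (nCk-absorption n (suc k)) ⟩
    suc n ℕ.* (n C k) ℕ.+ suc n C suc k ℕ.+ suc n ℕ.* (n C suc k)
      ≡⟨ merge n (n C k) (suc n C suc k) (n C suc k) ⟩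
    suc n ℕ.* (n C k ℕ.+ n C suc k) ℕ.+ suc n C suc k
      ≡⟨ cong (λ x → suc n ℕ.* x ℕ.+ suc n C suc k) (nCk+nC[k+1]≡[n+1]C[k+1] n k) ⟩
    suc n ℕ.* (suc n C suc k) ℕ.+ suc n C suc k
      ≡⟨ ℕₚ.+-comm (suc n ℕ.* (suc n C suc k)) _ ⟩
    suc (suc n) ℕ.* (suc n C suc k) ∎
    where
    open ≡-Reasoning
    split : ∀ k x y → suc (suc k) ℕ.* (x ℕ.+ y) ≡ suc k ℕ.* x ℕ.+ x ℕ.+ suc (suc k) ℕ.* y
    split = solve-∀
    merge : ∀ n a c d → suc n ℕ.* a ℕ.+ c ℕ.+ suc n ℕ.* d ≡ suc n ℕ.* (a ℕ.+ d) ℕ.+ c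
    merge = solve-∀

  [1+s+b]Cb*[1+s]≡[s+b]Cb*[1+s+b] : ∀ s b → ((suc s ℕ.+ b) C b) ℕ.* suc s ≡ ((s ℕ.+ b) C b) ℕ.* (suc s ℕ.+ b)
  [1+s+b]Cb*[1+s]≡[s+b]Cb*[1+s+b] s b = begin
    ((suc s ℕ.+ b) C b) ℕ.* suc s        ≡⟨ cong (ℕ._* suc s) (symmetric (suc s)) ⟩
    ((suc s ℕ.+ b) C suc s) ℕ.* suc s    ≡⟨ ℕₚ.*-comm _ (suc s) ⟩
    suc s ℕ.* (suc (s ℕ.+ b) C suc s)  ≡⟨ nCk-absorption (s ℕ.+ b) s ⟩
    suc (s ℕ.+ b) ℕ.* ((s ℕ.+ b) C s)  ≡⟨ cong (suc (s ℕ.+ b) ℕ.*_) (sym (symmetric s)) ⟩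
    suc (s ℕ.+ b) ℕ.* ((s ℕ.+ b) C b)  ≡⟨ ℕₚ.*-comm (suc (s ℕ.+ b)) _ ⟩
    ((s ℕ.+ b) C b) ℕ.* (suc s ℕ.+ b)    ∎
    where
    open ≡-Reasoning
    symmetric : ∀ s → (s ℕ.+ b) C b ≡ (s ℕ.+ b) C s
    symmetric s = trans (nCk≡nC[n∸k] (ℕₚ.m≤n+m b s)) (cong ((s ℕ.+ b) C_) (ℕₚ.m+n∸n≡m s b))

  1≤[s+k]Ck : ∀ s k → 1 ℕ.≤ (s ℕ.+ k) C k
  1≤[s+k]Ck s zero = s≤s z≤n
  1≤[s+k]Ck s (suc k) = subst (λ n → 1 ℕ.≤ n C suc k) (sym (ℕₚ.+-suc s k))
    (subst (1 ℕ.≤_) (nCk+nC[k+1]≡[n+1]C[k+1] (s ℕ.+ k) k) (ℕₚ.≤-trans (1≤[s+k]Ck s k) (ℕₚ.m≤m+n _ _)))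

  [s+4][s+1]/2≡[s+3]s/2+[s+2] : ∀ s → (suc (suc s) ℕ.+ 2) ℕ.* suc s ℕ./ 2 ≡ (suc s ℕ.+ 2) ℕ.* s ℕ./ 2 ℕ.+ suc (suc s)
  [s+4][s+1]/2≡[s+3]s/2+[s+2] s = begin
    (suc (suc s) ℕ.+ 2) ℕ.* suc s ℕ./ 2                  ≡⟨ cong (ℕ._/ 2) (expand s) ⟩
    ((suc s ℕ.+ 2) ℕ.* s ℕ.+ suc (suc s) ℕ.* 2) ℕ./ 2     ≡⟨ +-distrib-/-∣ʳ ((suc s ℕ.+ 2) ℕ.* s) (divides (suc (suc s)) refl) ⟩
    (suc s ℕ.+ 2) ℕ.* s ℕ./ 2 ℕ.+ suc (suc s) ℕ.* 2 ℕ./ 2 ≡⟨ cong ((suc s ℕ.+ 2) ℕ.* s ℕ./ 2 ℕ.+_) (m*n/n≡m (suc (suc s)) 2) ⟩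
    (suc s ℕ.+ 2) ℕ.* s ℕ./ 2 ℕ.+ suc (suc s)             ∎
    where
    open ≡-Reasoning
    expand : ∀ s → (suc (suc s) ℕ.+ 2) ℕ.* suc s ≡ (suc s ℕ.+ 2) ℕ.* s ℕ.+ suc (suc s) ℕ.* 2
    expand = solve-∀

  -- The base b = k + 2

  module Base (k : ℕ) where
    β b : ℕ
    β = suc k
    b = suc β

    1/b θ : ℚ
    1/b = 1ℚ ⊘ ℕ→ℚ b
    θ = ℕ→ℚ β * 1/b

    ratio : ℕ → ℚ
    ratio i = ℕ→ℚ (i ℕ.+ b ∸ 1) ⊘ ℕ→ℚ (i ℕ.+ b ∸ 2)

    ratio-telescope : ∀ i t → prodFrom ratio (suc i) t * ℕ→ℚ (i ℕ.+ β) ≡ ℕ→ℚ (i ℕ.+ t ℕ.+ β)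
    ratio-telescope i zero = trans (ℚₚ.*-identityˡ _) (cong (λ j → ℕ→ℚ (j ℕ.+ β)) (sym (ℕₚ.+-identityʳ i)))
    ratio-telescope i (suc t) = begin
      ratio (suc i) * R * ℕ→ℚ (i ℕ.+ β)
        ≡⟨ solve 3 (λ x y z → x :* y :* z := y :* (x :* z)) refl (ratio (suc i)) R (ℕ→ℚ (i ℕ.+ β)) ⟩
      R * (ratio (suc i) * ℕ→ℚ (i ℕ.+ β)) ≡⟨ cong (R *_) ratio-step ⟩
      R * ℕ→ℚ (suc i ℕ.+ β)                ≡⟨ ratio-telescope (suc i) t ⟩
      ℕ→ℚ (suc i ℕ.+ t ℕ.+ β)              ≡⟨ cong (λ j → ℕ→ℚ (j ℕ.+ β)) (sym (ℕₚ.+-suc i t)) ⟩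
      ℕ→ℚ (i ℕ.+ suc t ℕ.+ β)              ∎
      where
      open ≡-Reasoning
      R = prodFrom ratio (suc (suc i)) t
      i+β≡i+b∸1 : i ℕ.+ β ≡ i ℕ.+ b ∸ 1
      i+β≡i+b∸1 = cong (_∸ 1) (sym (ℕₚ.+-suc i β))
      ratio-step : ratio (suc i) * ℕ→ℚ (i ℕ.+ β) ≡ ℕ→ℚ (suc i ℕ.+ β)
      ratio-step = trans (cong (λ j → (ℕ→ℚ (i ℕ.+ b) ⊘ ℕ→ℚ j) * ℕ→ℚ (i ℕ.+ β)) (sym i+β≡i+b∸1))
        (trans (p⊘q*q≡p _ (pos⇒≢0 (subst (λ j → 0ℚ < ℕ→ℚ j) (sym (ℕₚ.+-suc i k)) (ℕ→ℚ-pos (i ℕ.+ k)))))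
               (cong ℕ→ℚ (ℕₚ.+-suc i β)))

    V W : ℕ → ℚ
    V t = ℕ→ℚ (β ℕ.^ t ℕ.* (t ℕ.+ β))
    W t = ℕ→ℚ (β ℕ.* b ℕ.^ t)

    0<W : ∀ t → 0ℚ < W t
    0<W t = ℕ→ℚ-mono-< (ℕₚ.*-mono-≤ {1} {β} {1} (s≤s z≤n) (ℕₚ.m^n>0 b t))

    u : ℕ → ℚ
    u t = θ ^ℚ t * prodFrom ratio 1 t

    θᵗbᵗ≡βᵗ : ∀ t → θ ^ℚ t * ℕ→ℚ b ^ℚ t ≡ ℕ→ℚ β ^ℚ t
    θᵗbᵗ≡βᵗ t = trans (sym (pow-*-distrib θ (ℕ→ℚ b) t)) (cong (_^ℚ t) θb≡β)
      where
      θb≡β : θ * ℕ→ℚ b ≡ ℕ→ℚ β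
      θb≡β = trans (ℚₚ.*-assoc (ℕ→ℚ β) 1/b (ℕ→ℚ b))
        (trans (cong (ℕ→ℚ β *_) (p⊘q*q≡p 1ℚ (pos⇒≢0 (ℕ→ℚ-pos β)))) (ℚₚ.*-identityʳ (ℕ→ℚ β)))

    u*W≡V : ∀ t → u t * W t ≡ V t
    u*W≡V t = begin
      θ ^ℚ t * R * W t
        ≡⟨ cong (θ ^ℚ t * R *_) (trans (ℕ→ℚ-homo-* β (b ℕ.^ t)) (cong (ℕ→ℚ β *_) (ℕ→ℚ-homo-^ b t))) ⟩
      θ ^ℚ t * R * (ℕ→ℚ β * ℕ→ℚ b ^ℚ t)
        ≡⟨ solve 4 (λ a r c d → a :* r :* (c :* d) := (r :* c) :* (a :* d)) refl (θ ^ℚ t) R (ℕ→ℚ β) (ℕ→ℚ b ^ℚ t) ⟩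
      (R * ℕ→ℚ β) * (θ ^ℚ t * ℕ→ℚ b ^ℚ t)            ≡⟨ cong₂ _*_ (ratio-telescope 0 t) (θᵗbᵗ≡βᵗ t) ⟩
      ℕ→ℚ (t ℕ.+ β) * ℕ→ℚ β ^ℚ t                      ≡⟨ ℚₚ.*-comm (ℕ→ℚ (t ℕ.+ β)) (ℕ→ℚ β ^ℚ t) ⟩
      ℕ→ℚ β ^ℚ t * ℕ→ℚ (t ℕ.+ β)
        ≡⟨ sym (trans (ℕ→ℚ-homo-* (β ℕ.^ t) (t ℕ.+ β)) (cong (_* ℕ→ℚ (t ℕ.+ β)) (ℕ→ℚ-homo-^ β t))) ⟩
      V t                                              ∎
      where
      open ≡-Reasoning
      R = prodFrom ratio 1 t

    0≤u : ∀ t → 0ℚ ≤ u t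
    0≤u t = *-cancelʳ-≤ (0<W t) (subst₂ _≤_ (sym (ℚₚ.*-zeroˡ (W t))) (sym (u*W≡V t)) (ℕ→ℚ-nonNeg (β ℕ.^ t ℕ.* (t ℕ.+ β))))

    u<1 : ∀ t → u (suc (suc t)) < 1ℚ
    u<1 t = *-cancelʳ-< (0<W (suc (suc t)))
      (subst₂ _<_ (sym (u*W≡V (suc (suc t)))) (sym (ℚₚ.*-identityˡ _)) (ℕ→ℚ-mono-< (βᵗ[t+β]<β[1+β]ᵗ k t)))

    u₁≡1 : u 1 ≡ 1ℚ
    u₁≡1 = *-cancelʳ-≡ (pos⇒≢0 (0<W 1)) (trans (u*W≡V 1) (trans (cong ℕ→ℚ V₁≡W₁) (sym (ℚₚ.*-identityˡ (W 1)))))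
      where
      V₁≡W₁ : β ℕ.^ 1 ℕ.* (1 ℕ.+ β) ≡ β ℕ.* b ℕ.^ 1
      V₁≡W₁ = trans (cong (ℕ._* b) (ℕₚ.*-identityʳ β)) (cong (β ℕ.*_) (sym (ℕₚ.*-identityʳ b)))

    t₀ : ℕ
    t₀ = 5 ℕ.* β ℕ.+ 5 ℕ.* β

    3u≤1 : ∀ t → t₀ ℕ.≤ t → ℕ→ℚ 3 * u (suc (suc t)) ≤ 1ℚ
    3u≤1 t t₀≤t = *-cancelʳ-≤ (0<W s) (subst₂ _≤_ 3V≡3uW (sym (ℚₚ.*-identityˡ (W s))) (ℕ→ℚ-mono-≤ 3V≤W))
      where
      s = suc (suc t)
      3V≤W : 3 ℕ.* (β ℕ.^ s ℕ.* (s ℕ.+ β)) ℕ.≤ β ℕ.* b ℕ.^ s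
      3V≤W = subst (λ s → 3 ℕ.* (β ℕ.^ s ℕ.* (s ℕ.+ β)) ℕ.≤ β ℕ.* b ℕ.^ s)
        (ℕₚ.m∸n+n≡m (ℕₚ.≤-trans t₀≤t (ℕₚ.≤-trans (ℕₚ.n≤1+n t) (ℕₚ.n≤1+n (suc t)))))
        (3βᵗ[t+β]≤β[1+β]ᵗ-eventually k (s ∸ t₀))
      3V≡3uW : ℕ→ℚ (3 ℕ.* (β ℕ.^ s ℕ.* (s ℕ.+ β))) ≡ ℕ→ℚ 3 * u s * W s
      3V≡3uW = trans (ℕ→ℚ-homo-* 3 (β ℕ.^ s ℕ.* (s ℕ.+ β)))
        (trans (cong (ℕ→ℚ 3 *_) (sym (u*W≡V s))) (sym (ℚₚ.*-assoc (ℕ→ℚ 3) (u s) (W s))))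

    F : ℕ → ℕ → ℚ
    F t n = θ ^ℚ n * partitionWeight ratio 1 t n n

    F₀₀≡1 : F 0 0 ≡ 1ℚ
    F₀₀≡1 = ℚₚ.*-identityˡ 1ℚ

    F₀-suc≡0 : ∀ n → F 0 (suc n) ≡ 0ℚ
    F₀-suc≡0 n = ℚₚ.*-zeroʳ (θ ^ℚ suc n)

    F-vanish : ∀ t n → n ℕ.< t → F t n ≡ 0ℚ
    F-vanish t n n<t = trans (cong (θ ^ℚ n *_) (partitionWeight-vanish ratio 1 t n n n<t)) (ℚₚ.*-zeroʳ (θ ^ℚ n))

    F-rec : ∀ t n → F (suc t) (n ℕ.+ suc t) ≡ u (suc t) * (F (suc t) n + F t n)
    F-rec t n = begin
      θ ^ℚ (n ℕ.+ suc t) * partitionWeight ratio 1 (suc t) (n ℕ.+ suc t) (n ℕ.+ suc t)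
        ≡⟨ cong₂ _*_ (pow-+ θ n (suc t)) (cong (λ m → partitionWeight ratio 1 (suc t) m (n ℕ.+ suc t)) (ℕₚ.+-suc n t)) ⟩
      θ ^ℚ n * θ ^ℚ suc t * partitionWeight ratio 1 (suc t) (suc (n ℕ.+ t)) (n ℕ.+ suc t)
        ≡⟨ cong (θ ^ℚ n * θ ^ℚ suc t *_) (shift-identity ratio (n ℕ.+ t) 1 t n) ⟩
      θ ^ℚ n * θ ^ℚ suc t * (R * (partitionWeight ratio 1 (suc t) (n ℕ.+ t) n + partitionWeight ratio 1 t (n ℕ.+ t) n))
        ≡⟨ cong₂ (λ x y → θ ^ℚ n * θ ^ℚ suc t * (R * (x + y))) (stable (suc t)) (stable t) ⟩
      θ ^ℚ n * θ ^ℚ suc t * (R * (partitionWeight ratio 1 (suc t) n n + partitionWeight ratio 1 t n n))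
        ≡⟨ solve 5 (λ a c r x y → a :* c :* (r :* (x :+ y)) := c :* r :* (a :* x :+ a :* y)) refl
             (θ ^ℚ n) (θ ^ℚ suc t) R (partitionWeight ratio 1 (suc t) n n) (partitionWeight ratio 1 t n n) ⟩
      u (suc t) * (F (suc t) n + F t n) ∎
      where
      open ≡-Reasoning
      R = prodFrom ratio 1 (suc t)
      stable : ∀ t′ → partitionWeight ratio 1 t′ (n ℕ.+ t) n ≡ partitionWeight ratio 1 t′ n n
      stable t′ = trans (cong (λ m → partitionWeight ratio 1 t′ m n) (ℕₚ.+-comm n t)) (partitionWeight-stable ratio 1 t′ t n)

    binom : ℕ → ℚ
    binom t = ℕ→ℚ ((t ℕ.+ b ∸ 1) C b)

    1≤binom : ∀ s → 1ℚ ≤ binom (suc s)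
    1≤binom s = ℕ→ℚ-mono-≤ (1≤[s+k]Ck s b)

    0<binom : ∀ s → 0ℚ < binom (suc s)
    0<binom s = ℚₚ.<-≤-trans (ℚₚ.positive⁻¹ 1ℚ) (1≤binom s)

    binom-step : ∀ s → binom (suc (suc s)) * ℕ→ℚ (suc s) ≡ binom (suc s) * ℕ→ℚ (suc s ℕ.+ b)
    binom-step s = trans (sym (ℕ→ℚ-homo-* ((suc s ℕ.+ b) C b) (suc s)))
      (trans (cong ℕ→ℚ ([1+s+b]Cb*[1+s]≡[s+b]Cb*[1+s+b] s b)) (ℕ→ℚ-homo-* ((s ℕ.+ b) C b) (suc s ℕ.+ b)))

    G : ℕ → ℚ
    G t = gammaTerm b t * binom t

    G₁≡1 : G 1 ≡ 1ℚ
    G₁≡1 = cong (gammaTerm b 1 *_) (cong ℕ→ℚ (nCn≡1 b))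

    Dℚ : ℕ → ℚ
    Dℚ s = ℤ→ℚ (D b (suc (suc s)))

    Dℚ≡W-V : ∀ s → Dℚ s ≡ W (suc (suc s)) - V (suc (suc s))
    Dℚ≡W-V s = trans (ℤ→ℚ-homo-− (ℤ.+ (β ℕ.* b ℕ.^ suc (suc s))) (ℤ.+ (β ℕ.^ suc (suc s) ℕ.* (β ℕ.+ suc (suc s)))))
      (cong (λ j → W (suc (suc s)) - ℕ→ℚ (β ℕ.^ suc (suc s) ℕ.* j)) (ℕₚ.+-comm β (suc (suc s))))

    0<Dℚ : ∀ s → 0ℚ < Dℚ s
    0<Dℚ s = subst (0ℚ <_) (sym (Dℚ≡W-V s)) (p<q⇒0<q-p (ℕ→ℚ-mono-< (βᵗ[t+β]<β[1+β]ᵗ k s)))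

    den : ℕ → ℚ
    den s = ℤ→ℚ (prodD b (suc s))

    den-step : ∀ s → den (suc s) ≡ den s * Dℚ s
    den-step s = ℤ→ℚ-homo-* (prodD b (suc s)) (D b (suc (suc s)))

    0<den : ∀ s → 0ℚ < den s
    0<den zero = ℚₚ.positive⁻¹ 1ℚ
    0<den (suc s) = subst (0ℚ <_) (sym (den-step s)) (*-pos (0<den s) (0<Dℚ s))

    num : ℕ → ℚ
    num s = ℕ→ℚ (s ℕ.! ℕ.* β ℕ.^ ((suc s ℕ.+ 2) ℕ.* s ℕ./ 2))

    gammaTerm*den≡num : ∀ s → gammaTerm b (suc s) * den s ≡ num s
    gammaTerm*den≡num s = p⊘q*q≡p (num s) (pos⇒≢0 (0<den s))

    num-step : ∀ s → num (suc s) ≡ num s * (ℕ→ℚ (suc s) * ℕ→ℚ β ^ℚ suc (suc s))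
    num-step s = begin
      ℕ→ℚ (suc s ℕ.! ℕ.* β ℕ.^ e₁)
        ≡⟨ cong (λ e → ℕ→ℚ (suc s ℕ.! ℕ.* β ℕ.^ e)) ([s+4][s+1]/2≡[s+3]s/2+[s+2] s) ⟩
      ℕ→ℚ (suc s ℕ.! ℕ.* β ℕ.^ (e₀ ℕ.+ suc (suc s)))
        ≡⟨ cong (λ x → ℕ→ℚ (suc s ℕ.! ℕ.* x)) (ℕₚ.^-distribˡ-+-* β e₀ (suc (suc s))) ⟩
      ℕ→ℚ ((suc s ℕ.* s ℕ.!) ℕ.* (β ℕ.^ e₀ ℕ.* β ℕ.^ suc (suc s)))
        ≡⟨ cong ℕ→ℚ (rearrange (suc s) (s ℕ.!) (β ℕ.^ e₀) (β ℕ.^ suc (suc s))) ⟩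
      ℕ→ℚ ((s ℕ.! ℕ.* β ℕ.^ e₀) ℕ.* (suc s ℕ.* β ℕ.^ suc (suc s)))
        ≡⟨ trans (ℕ→ℚ-homo-* (s ℕ.! ℕ.* β ℕ.^ e₀) (suc s ℕ.* β ℕ.^ suc (suc s)))
                 (cong (num s *_) (trans (ℕ→ℚ-homo-* (suc s) (β ℕ.^ suc (suc s)))
                                         (cong (ℕ→ℚ (suc s) *_) (ℕ→ℚ-homo-^ β (suc (suc s)))))) ⟩
      num s * (ℕ→ℚ (suc s) * ℕ→ℚ β ^ℚ suc (suc s)) ∎
      where
      open ≡-Reasoning
      e₀ = (suc s ℕ.+ 2) ℕ.* s ℕ./ 2
      e₁ = (suc (suc s) ℕ.+ 2) ℕ.* suc s ℕ./ 2
      rearrange : ∀ a f P Q → (a ℕ.* f) ℕ.* (P ℕ.* Q) ≡ (f ℕ.* P) ℕ.* (a ℕ.* Q)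
      rearrange = solve-∀

    V≡βᵗ[s+1+b] : ∀ s → V (suc (suc s)) ≡ ℕ→ℚ β ^ℚ suc (suc s) * ℕ→ℚ (suc s ℕ.+ b)
    V≡βᵗ[s+1+b] s = trans (ℕ→ℚ-homo-* (β ℕ.^ suc (suc s)) (suc (suc s) ℕ.+ β))
      (cong₂ _*_ (ℕ→ℚ-homo-^ β (suc (suc s))) (cong ℕ→ℚ (sym (cong suc (ℕₚ.+-suc s β)))))

    G-ratio : ∀ s → G (suc (suc s)) * Dℚ s ≡ V (suc (suc s)) * G (suc s)
    G-ratio s = *-cancelʳ-≡ (pos⇒≢0 (*-pos (0<den s) (ℕ→ℚ-pos s))) (trans lhs (sym rhs))
      where
      open ≡-Reasoning
      γ₁ = gammaTerm b (suc s)
      γ₂ = gammaTerm b (suc (suc s))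
      C₁ = binom (suc s)
      C₂ = binom (suc (suc s))
      s+1 = ℕ→ℚ (suc s)
      s+1+b = ℕ→ℚ (suc s ℕ.+ b)
      βˢ⁺² = ℕ→ℚ β ^ℚ suc (suc s)
      lhs : γ₂ * C₂ * Dℚ s * (den s * s+1) ≡ num s * (s+1 * βˢ⁺²) * (C₁ * s+1+b)
      lhs = begin
        γ₂ * C₂ * Dℚ s * (den s * s+1)
          ≡⟨ solve 5 (λ g c d e x → g :* c :* d :* (e :* x) := (g :* (e :* d)) :* (c :* x)) refl γ₂ C₂ (Dℚ s) (den s) s+1 ⟩
        (γ₂ * (den s * Dℚ s)) * (C₂ * s+1)  ≡⟨ cong₂ (λ x y → (γ₂ * x) * y) (sym (den-step s)) (binom-step s) ⟩
        (γ₂ * den (suc s)) * (C₁ * s+1+b)   ≡⟨ cong (_* (C₁ * s+1+b)) (trans (gammaTerm*den≡num (suc s)) (num-step s)) ⟩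
        num s * (s+1 * βˢ⁺²) * (C₁ * s+1+b) ∎
      rhs : V (suc (suc s)) * (γ₁ * C₁) * (den s * s+1) ≡ num s * (s+1 * βˢ⁺²) * (C₁ * s+1+b)
      rhs = begin
        V (suc (suc s)) * (γ₁ * C₁) * (den s * s+1)
          ≡⟨ solve 5 (λ v g c e x → v :* (g :* c) :* (e :* x) := v :* (g :* e) :* c :* x) refl (V (suc (suc s))) γ₁ C₁ (den s) s+1 ⟩
        V (suc (suc s)) * (γ₁ * den s) * C₁ * s+1   ≡⟨ cong₂ (λ x y → x * y * C₁ * s+1) (V≡βᵗ[s+1+b] s) (gammaTerm*den≡num s) ⟩
        βˢ⁺² * s+1+b * num s * C₁ * s+1
          ≡⟨ solve 5 (λ p l n c x → p :* l :* n :* c :* x := n :* (x :* p) :* (c :* l)) refl βˢ⁺² s+1+b (num s) C₁ s+1 ⟩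
        num s * (s+1 * βˢ⁺²) * (C₁ * s+1+b)         ∎

    G-rec : ∀ s → G (suc (suc s)) ≡ u (suc (suc s)) * (G (suc (suc s)) + G (suc s))
    G-rec s = x[1-u]≡uy⇒x≡u[x+y] G₂ U G₁ (*-cancelʳ-≡ (pos⇒≢0 (0<W (suc (suc s)))) (begin
      G₂ * (1ℚ - U) * W₂  ≡⟨ solve 3 (λ g u w → g :* (con 1ℚ :- u) :* w := g :* (w :- u :* w)) refl G₂ U W₂ ⟩
      G₂ * (W₂ - U * W₂)  ≡⟨ cong (λ x → G₂ * (W₂ - x)) (u*W≡V (suc (suc s))) ⟩
      G₂ * (W₂ - V₂)      ≡⟨ cong (G₂ *_) (sym (Dℚ≡W-V s)) ⟩
      G₂ * Dℚ s           ≡⟨ G-ratio s ⟩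
      V₂ * G₁             ≡⟨ cong (_* G₁) (sym (u*W≡V (suc (suc s)))) ⟩
      U * W₂ * G₁         ≡⟨ solve 3 (λ u w g → u :* w :* g := u :* g :* w) refl U W₂ G₁ ⟩
      U * G₁ * W₂         ∎))
      where
      open ≡-Reasoning
      U = u (suc (suc s))
      G₁ = G (suc s)
      G₂ = G (suc (suc s))
      V₂ = V (suc (suc s))
      W₂ = W (suc (suc s))

    c : ℕ → ℚ
    c t = 1/b * (1ℚ ⊘ binom (suc t))

    0≤c : ∀ t → 0ℚ ≤ c t
    0≤c t = *-nonNeg (ℚₚ.<⇒≤ (1⊘q-pos (ℕ→ℚ-pos β))) (ℚₚ.<⇒≤ (1⊘q-pos (0<binom t)))

    c≤1 : ∀ t → c t ≤ 1ℚ
    c≤1 t = ℚₚ.≤-trans (*-monoˡ-≤ (ℚₚ.<⇒≤ (1⊘q-pos (ℕ→ℚ-pos β))) (1⊘q≤1 (1≤binom t)))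
      (subst (_≤ 1ℚ) (sym (ℚₚ.*-identityʳ 1/b)) (1⊘q≤1 (ℕ→ℚ-mono-≤ {1} {b} (s≤s z≤n))))

    prodFactor≡weight : ∀ i ps → prodFactor b i ps ≡ weight ratio i ps
    prodFactor≡weight i [] = refl
    prodFactor≡weight i (p ∷ ps) = cong (ratio i ^ℚ p *_) (prodFactor≡weight (suc i) ps)

    S/bⁿ≡ΣcF : ∀ n → S b n ⊘ ℕ→ℚ (b ℕ.^ n) ≡ sumFrom (λ t → c t * F (suc t) n) 0 n
    S/bⁿ≡ΣcF n = z*q≡p⇒p⊘q≡z (pos⇒≢0 (ℕ→ℚ-mono-< (ℕₚ.m^n>0 b n))) (begin
      sumFrom (λ t → c t * F (suc t) n) 0 n * ℕ→ℚ (b ℕ.^ n)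
        ≡⟨ trans (ℚₚ.*-comm _ (ℕ→ℚ (b ℕ.^ n))) (sym (sumFrom-*ˡ (ℕ→ℚ (b ℕ.^ n)) (λ t → c t * F (suc t) n) 0 n)) ⟩
      sumFrom (λ t → ℕ→ℚ (b ℕ.^ n) * (c t * F (suc t) n)) 0 n
        ≡⟨ sumFrom-cong 0 n term≡ ⟩
      sumFrom (λ t → 1/b * (h (suc t) * q (suc t))) 0 n
        ≡⟨ sumFrom-*ˡ 1/b (λ t → h (suc t) * q (suc t)) 0 n ⟩
      1/b * sumFrom (λ t → h (suc t) * q (suc t)) 0 n
        ≡⟨ cong (1/b *_) (sym (trans (cong₂ _+_ (ℚₚ.*-zeroˡ (q 0)) (sumFrom-shift (λ t → h t * q t) 0 n)) (ℚₚ.+-identityˡ _))) ⟩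
      1/b * sumFrom (λ t → h t * q t) 0 (suc n)
        ≡⟨ cong (1/b *_) (sym (trans (cong sumℚ (Listₚ.map-cong partTerm≡ (distinctParts n n)))
                                     (sum-by-length ratio h 1 n n ℕₚ.≤-refl n))) ⟩
      S b n ∎)
      where
      open ≡-Reasoning
      h : ℕ → ℚ
      h zero = 0ℚ
      h (suc t) = ℕ→ℚ (β ℕ.^ n) ⊘ binom (suc t)
      q : ℕ → ℚ
      q t = partitionWeight ratio 1 t n n
      partTerm≡ : ∀ ps → partTerm b n ps ≡ h (length ps) * weight ratio 1 ps
      partTerm≡ [] = sym (ℚₚ.*-zeroˡ 1ℚ)
      partTerm≡ (p ∷ ps) = cong (h (suc (length ps)) *_) (prodFactor≡weight 1 (p ∷ ps))
      term≡ : ∀ t → ℕ→ℚ (b ℕ.^ n) * (c t * F (suc t) n) ≡ 1/b * (h (suc t) * q (suc t))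
      term≡ t = begin
        ℕ→ℚ (b ℕ.^ n) * (1/b * w * (θ ^ℚ n * q (suc t)))
          ≡⟨ cong (λ x → x * (1/b * w * (θ ^ℚ n * q (suc t)))) (ℕ→ℚ-homo-^ b n) ⟩
        ℕ→ℚ b ^ℚ n * (1/b * w * (θ ^ℚ n * q (suc t)))
          ≡⟨ solve 5 (λ B i w T x → B :* (i :* w :* (T :* x)) := i :* ((T :* B) :* w :* x)) refl (ℕ→ℚ b ^ℚ n) 1/b w (θ ^ℚ n) (q (suc t)) ⟩
        1/b * ((θ ^ℚ n * ℕ→ℚ b ^ℚ n) * w * q (suc t))
          ≡⟨ cong (λ x → 1/b * (x * w * q (suc t))) (trans (θᵗbᵗ≡βᵗ n) (sym (ℕ→ℚ-homo-^ β n))) ⟩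
        1/b * (ℕ→ℚ (β ℕ.^ n) * w * q (suc t))
          ≡⟨ cong (λ x → 1/b * (x * q (suc t))) (sym (p⊘q≡p*[1⊘q] (ℕ→ℚ (β ℕ.^ n)) (binom (suc t)))) ⟩
        1/b * (h (suc t) * q (suc t)) ∎
        where w = 1ℚ ⊘ binom (suc t)

    gammaPartial≡ΣcG : ∀ T → gammaPartial b T ≡ sumFrom (λ t → c t * G (suc t)) 0 T
    gammaPartial≡ΣcG T = begin
      1/b * gammaSum b T                                     ≡⟨ cong (1/b *_) (gammaSum≡ T) ⟩
      1/b * sumFrom (λ t → gammaTerm b (suc t)) 0 T          ≡⟨ sym (sumFrom-*ˡ 1/b (λ t → gammaTerm b (suc t)) 0 T) ⟩
      sumFrom (λ t → 1/b * gammaTerm b (suc t)) 0 T          ≡⟨ sumFrom-cong 0 T term≡ ⟩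
      sumFrom (λ t → c t * G (suc t)) 0 T                    ∎
      where
      open ≡-Reasoning
      gammaSum≡ : ∀ T → gammaSum b T ≡ sumFrom (λ t → gammaTerm b (suc t)) 0 T
      gammaSum≡ zero = refl
      gammaSum≡ (suc T) = trans (cong (_+ gammaTerm b (suc T)) (gammaSum≡ T)) (sym (sumFrom-last (λ t → gammaTerm b (suc t)) 0 T))
      term≡ : ∀ t → 1/b * gammaTerm b (suc t) ≡ c t * G (suc t)
      term≡ t = begin
        1/b * γ                        ≡⟨ cong (1/b *_) (sym (ℚₚ.*-identityʳ γ)) ⟩
        1/b * (γ * 1ℚ)                 ≡⟨ cong (λ x → 1/b * (γ * x)) (sym (p⊘q*q≡p 1ℚ (pos⇒≢0 (0<binom t)))) ⟩
        1/b * (γ * (w * binom (suc t)))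
          ≡⟨ solve 4 (λ i g w C → i :* (g :* (w :* C)) := i :* w :* (g :* C)) refl 1/b γ w (binom (suc t)) ⟩
        c t * G (suc t)                ∎
        where
        γ = gammaTerm b (suc t)
        w = 1ℚ ⊘ binom (suc t)

open import Defs
open import Data.Nat using (ℕ; _≤_)
open import Data.Rational using (ℚ; 0ℚ; _<_; _-_; ∣_∣)
open import Data.Product using (∃-syntax)
open import Data.Nat using (zero; suc; s≤s)
open import Data.Rational using (_*_)
open import Data.Product using (_,_)
open import Relation.Binary.PropositionalEquality using (subst₂; sym)

theorem6p7 : (b : ℕ) → 2 ≤ b → (ε : ℚ) → 0ℚ < ε →
    ∃[ N ] ∃[ T₀ ] ((n T : ℕ) → N ≤ n → T₀ ≤ T →
      ∣ (S b n ⊘ ℕ→ℚ (b Data.Nat.^ n)) - gammaPartial b T ∣ < ε)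
theorem6p7 (suc zero) (s≤s ())
theorem6p7 (suc (suc k)) _ ε 0<ε = rewrite-sums (weighted-sums-converge c 0≤c c≤1 t₀ 3u≤1 ε 0<ε)
  where
  open Base k
  open Recurrence u F G 0≤u u<1 u₁≡1 F₀₀≡1 F₀-suc≡0 F-vanish F-rec G₁≡1 G-rec
  rewrite-sums : ∃[ N ] ∃[ T₀ ] ((n T : ℕ) → N ≤ n → T₀ ≤ T →
                   ∣ sumFrom (λ t → c t * F (suc t) n) 0 n - sumFrom (λ t → c t * G (suc t)) 0 T ∣ < ε) →
                 ∃[ N ] ∃[ T₀ ] ((n T : ℕ) → N ≤ n → T₀ ≤ T →
                   ∣ (S b n ⊘ ℕ→ℚ (b Data.Nat.^ n)) - gammaPartial b T ∣ < ε)
  rewrite-sums (N , T₀ , close) = N , T₀ , λ n T N≤n T₀≤T →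
    subst₂ (λ x y → ∣ x - y ∣ < ε) (sym (S/bⁿ≡ΣcF n)) (sym (gammaPartial≡ΣcG T)) (close n T N≤n T₀≤T)
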